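{- Let $\alpha\in\mathbb Q\cap(0,1)$ and let $(\beta,\gamma)$ be its Farey parent. Then (1) $\mathcal{S}_{\mathfrak{r}(\alpha)}(q)=\mathcal{S}^\vee_\alpha(q)=\mathcal{S}_{\mathfrak{i}(\alpha)}(q)=\mathcal{R}_{\alpha^{ -1}}(q)$; (2) $\mathcal{R}_{\mathfrak{i}(\alpha)}(q)=\mathcal{R}_{\alpha^{ -1}}(q)-\mathcal{S}_{\alpha^{ -1}}(q)$ and $\mathcal{R}_{\mathfrak{r}(\alpha)}(q)=\mathcal{R}_{\alpha^{ -1}}(q)-\mathcal{R}_{\gamma^{ -1}}(q)$.
   Context: For an integer $c$, $[c]_q=\frac{1-q^c}{1-q}$. Every rational $\alpha>1$ has a unique negative continued fraction expansion $\alpha=c_1-\cfrac{1}{c_2-\cfrac{1}{\ddots-\cfrac{1}{c_l}}}$ with integers $c_j\ge 2$. Put $M^-_q(c)=\begin{pmatrix}[c]_q & -q^{c-1}\\ 1 & 0\end{pmatrix}$ and define $\mathcal{R}_\alpha(q),\mathcal{S}_\alpha(q)$ by $\begin{pmatrix}\mathcal{R}_\alpha(q)\\ \mathcal{S}_\alpha(q)\end{pmatrix}=M^-_q(c_1)\cdots M^-_q(c_l)\begin{pmatrix}1\\0\end{pmatrix}$; for rational $\alpha\le1$ they are defined recursively by $\mathcal{S}_\alpha=\mathcal{S}_{\alpha+1}$, $\mathcal{R}_\alpha=q^{ -1}(\mathcal{R}_{\alpha+1}-\mathcal{S}_{\alpha+1})$. For a nonzero polynomial $f$, $f^\vee(q)=q^{\deg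 f}f(q^{ -1})$. Fractions are irreducible with nonnegative denominator. Two irreducible fractions $\frac{x}{a},\frac{y}{b}$ are Farey neighbors if $ay-bx=1$. Every positive rational $\alpha$ can be written uniquely as $\alpha=\frac{x+y}{a+b}$ with $ay-bx=1$; $(\beta,\gamma)=(\frac{x}{a},\frac{y}{b})$ is its Farey parent. For $\alpha=\frac{z}{c}\in(0,1)$ with Farey parent $(\frac{x}{a},\frac{y}{b})$ define $\mathfrak{i}(\alpha)=\frac{c-z}{c}$ and $\mathfrak{r}(\alpha)=\frac{a}{c}$. -}

module Defs where

open import Data.Nat as ℕ using (ℕ; zero; suc)
import Data.Nat.DivMod as ℕD
open import Data.Integer as ℤ using (ℤ; +_; +[1+_]; -[1+_])
open import Data.List as List using (List; []; _∷_; _++_; replicate; reverse; foldr)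
open import Data.Product using (_×_; _,_; proj₁; proj₂)
open import Data.Rational as ℚ using (ℚ; mkℚ; ↥_; ↧_; ↧ₙ_; 0ℚ; 1ℚ)
open import Data.Rational.Properties using (_<?_)
open import Relation.Nullary using (yes; no)
open import Relation.Binary.PropositionalEquality using (_≡_)

-- Laurent polynomials in q with integer coefficients.
-- ⟨ l , [a₀,…,aₖ] ⟩ denotes  Σᵢ aᵢ q^(l+i).

record LPoly : Set where
  constructor ⟨_,_⟩
  field
    low : ℤ
    cs  : List ℤ
open LPoly public

nth : List ℤ → ℕ → ℤ
nth []       _       = + 0
nth (a ∷ as) zero    = a
nth (a ∷ as) (suc i) = nth as i

coeff : LPoly → ℤ → ℤ
coeff f n with n ℤ.- low f
... | + i      = nth (cs f) i
... | -[1+ _ ] = + 0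

infix 4 _≈_
_≈_ : LPoly → LPoly → Set
f ≈ g = ∀ n → coeff f n ≡ coeff g n

addL : List ℤ → List ℤ → List ℤ
addL []       bs       = bs
addL as       []       = as
addL (a ∷ as) (b ∷ bs) = (a ℤ.+ b) ∷ addL as bs

mulL : List ℤ → List ℤ → List ℤ
mulL []       bs = []
mulL (a ∷ as) bs = addL (List.map (a ℤ.*_) bs) (+ 0 ∷ mulL as bs)

0P : LPoly
0P = ⟨ + 0 , [] ⟩

1P : LPoly
1P = ⟨ + 0 , + 1 ∷ [] ⟩

qpow : ℤ → LPoly
qpow k = ⟨ k , + 1 ∷ [] ⟩

infixl 6 _+P_ _-P_
infixl 7 _*P_

_+P_ : LPoly → LPoly → LPoly
⟨ l₁ , c₁ ⟩ +P ⟨ l₂ , c₂ ⟩ =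
  ⟨ m , addL (replicate ℤ.∣ l₁ ℤ.- m ∣ (+ 0) ++ c₁)
             (replicate ℤ.∣ l₂ ℤ.- m ∣ (+ 0) ++ c₂) ⟩
  where m = l₁ ℤ.⊓ l₂

-P_ : LPoly → LPoly
-P ⟨ l , c ⟩ = ⟨ l , List.map ℤ.-_ c ⟩

_-P_ : LPoly → LPoly → LPoly
f -P g = f +P (-P g)

_*P_ : LPoly → LPoly → LPoly
⟨ l₁ , c₁ ⟩ *P ⟨ l₂ , c₂ ⟩ = ⟨ l₁ ℤ.+ l₂ , mulL c₁ c₂ ⟩

-- q-integer [c]_q = (1 - q^c)/(1 - q) = 1 + q + … + q^(c-1) for c ∈ ℕ
qint : ℕ → LPoly
qint c = ⟨ + 0 , replicate c (+ 1) ⟩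

dropZ : List ℤ → List ℤ
dropZ []            = []
dropZ (+ 0 ∷ as)    = dropZ as
dropZ (a ∷ as)      = a ∷ as

trimTop : List ℤ → List ℤ
trimTop as = reverse (dropZ (reverse as))

-- f^∨(q) = q^(deg f) f(q⁻¹): if f = Σ_{i} aᵢ q^(l+i) with top nonzero
-- coefficient a_t (deg f = l + t), then f^∨ = Σ_i aᵢ q^(t-i),
-- i.e. the reversed (top-trimmed) coefficient list starting at q^0.
vee : LPoly → LPoly
vee ⟨ l , c ⟩ = ⟨ + 0 , reverse (trimTop c) ⟩

-- Negative continued fraction expansion of n/d > 1 (gcd(n,d)=1):
-- c₁ = ⌈n/d⌉ and n/d = c₁ - 1/(d/(c₁ d - n)); stops when d = 1.
-- The first argument is fuel (d suffices, since denominators decrease).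

negCF : ℕ → ℕ → ℕ → List ℕ
negCF zero     n d             = []
negCF (suc f)  n zero          = []
negCF (suc f)  n (suc zero)    = n ∷ []
negCF (suc f)  n (suc (suc e)) =
  c ∷ negCF f (suc (suc e)) (c ℕ.* suc (suc e) ℕ.∸ n)
  where c = suc (n ℕD./ suc (suc e))

stepM : ℕ → LPoly × LPoly → LPoly × LPoly
stepM c (r , s) = (qint c *P r -P qpow (+ c ℤ.- + 1) *P s , r)

RS>1 : ℚ → LPoly × LPoly
RS>1 α = foldr stepM (1P , 0P) (negCF (↧ₙ α) ℤ.∣ ↥ α ∣ (↧ₙ α))

-- general α: for α ≤ 1, S_α = S_{α+1}, R_α = q⁻¹ (R_{α+1} - S_{α+1}).
-- The fuel only guarantees termination (|↥α| + 2 steps always suffice).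
RSfuel : ℕ → ℚ → LPoly × LPoly
RSfuel fuel α with 1ℚ <? α
RSfuel fuel    α | yes _ = RS>1 α
RSfuel zero    α | no  _ = (0P , 0P)
RSfuel (suc f) α | no  _ with RSfuel f (α ℚ.+ 1ℚ)
... | (r , s) = (qpow (-[1+ 0 ]) *P (r -P s) , s)

RS : ℚ → LPoly × LPoly
RS α = RSfuel (ℤ.∣ ↥ α ∣ ℕ.+ 2) α

𝓡 : ℚ → LPoly
𝓡 α = proj₁ (RS α)

𝓢 : ℚ → LPoly
𝓢 α = proj₂ (RS α)

-- reciprocal (only used on positive rationals; 0 ↦ 0 is a dummy value)
inv : ℚ → ℚ
inv (mkℚ (+ 0) d _)          = 0ℚ
inv p@(mkℚ +[1+ n ] d _)     = ℚ.1/ p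
inv p@(mkℚ -[1+ n ] d _)     = ℚ.1/ p

-- Farey parent: α = (x+y)/(a+b) with β = x/a, γ = y/b, a y - b x = 1
record FareyParent (α β γ : ℚ) : Set where
  field
    neighbors : ↧ β ℤ.* ↥ γ ℤ.- ↧ γ ℤ.* ↥ β ≡ + 1
    num≡      : ↥ α ≡ ↥ β ℤ.+ ↥ γ
    den≡      : ↧ₙ α ≡ ↧ₙ β ℕ.+ ↧ₙ γ

𝔦 : ℚ → ℚ
𝔦 α = (+ (↧ₙ α) ℤ.- ↥ α) ℚ./ (↧ₙ α)

𝔯 : ℚ → ℚ → ℚ
𝔯 α β = ↧ β ℚ./ (↧ₙ α)

-- Words in R = (1 1; 0 1) and L = (1 0; 1 1) are the paths of the Stern–Brocot tree: every
-- positive fraction n/d is w (1,1) for a word w, and the columns of the matrix of w are the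
-- Farey parents of n/d.  In the negative continued fraction of n/d > 1 each factor splits as
-- M⁻(c) = R^(c−1) M⁻(1), and M⁻(1) R = L.  Both identities survive q-deformation, so
-- (𝓡_α, 𝓢_α) = w_q (1,1), also for α ≤ 1, where the recursion from α + 1 strips a leading R.
-- If α = z/c < 1 has Farey parent (x/a, y/b), its word is L u with matrix (y x; b a); then
-- 1/α, 𝔦(α), 𝔯(α) and 1/γ are the fractions of flip(L u) (R and L exchanged), L flip(u),
-- L reverse(u), and of the word whose fraction is the second column of flip(L u).  Exchanging
-- R and L amounts to q ↦ q⁻¹ up to a power of q, and reversing a word transposes its matrix up
-- to the same reflection.  As 𝓢 of L u has degree |u| + 1 and leading coefficient 1, that
-- reflection is 𝓢^∨, and the five identities become identities between the coefficients of the
-- entries of the matrix of u.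

module Submission where

open import Defs
open import Data.Product using (_×_)
open import Data.Rational using (ℚ; 0ℚ; 1ℚ; _<_)

open import Data.Nat as ℕ using (ℕ; zero; suc; z≤n; s≤s)
import Data.Nat.Properties as ℕP
import Data.Nat.DivMod as ℕD
open import Data.Nat.Divisibility using (divides)
open import Data.Nat.Coprimality as Coprimality using (Coprime)
import Data.Nat.Tactic.RingSolver as ℕ-Solver
open import Data.Integer as ℤ using (ℤ; +<+; +_; -[1+_]; +[1+_]; _+_; _-_; -_; _*_; _≤_; _⊓_; ∣_∣)
import Data.Integer.Properties as ℤP
open import Data.Integer.Tactic.RingSolver using (solve-∀)
open import Data.Rational as ℚ using (mkℚ; ↥_; ↧_; ↧ₙ_)
import Data.Rational.Properties as ℚP
open import Data.List as List using (List; []; _∷_; _++_; replicate; reverse; length; _ʳ++_)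
import Data.List.Properties as ListP
open import Data.List.Relation.Unary.All using (All; []; _∷_)
open import Data.Product using (_,_; proj₁; proj₂; ∃-syntax; swap)
open import Data.Product.Relation.Binary.Pointwise.NonDependent using (Pointwise)
open import Data.Sum using (_⊎_; inj₁; inj₂)
open import Data.Empty using (⊥-elim)
open import Relation.Nullary using (¬_; Dec; yes; no)
open import Relation.Binary.Bundles using (Setoid)
import Relation.Binary.Reasoning.Setoid as SetoidReasoning
import Algebra.Properties.CommutativeSemigroup as CommutativeSemigroupProperties
open import Relation.Binary.PropositionalEquality

module ℕ+ = CommutativeSemigroupProperties ℕP.+-commutativeSemigroup
module ℤ+ = CommutativeSemigroupProperties ℤP.+-commutativeSemigroup

-- Coefficient sequences of Laurent polynomials

Coeffs : Set
Coeffs = ℤ → ℤ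

infixl 6 _⊕_ _⊝_

_⊕_ _⊝_ : Coeffs → Coeffs → Coeffs
(f ⊕ g) n = f n + g n
(f ⊝ g) n = f n - g n

shift : ℤ → Coeffs → Coeffs
shift k f n = f (n - k)

qint· : ℕ → Coeffs → Coeffs
qint· zero    g n = + 0
qint· (suc c) g n = g n + qint· c g (n - + 1)

qint·-cong : ∀ c {g h} → g ≗ h → qint· c g ≗ qint· c h
qint·-cong zero    g≗h n = refl
qint·-cong (suc c) g≗h n = cong₂ _+_ (g≗h n) (qint·-cong c g≗h (n - + 1))

private
  -‿comm : ∀ n j k → n - j - k ≡ n - k - j
  -‿comm = solve-∀

qint·-shift : ∀ c g k → qint· c (shift k g) ≗ shift k (qint· c g)
qint·-shift zero    g k n = refl
qint·-shift (suc c) g k n =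
  cong (_+_ (g (n - k))) (trans (qint·-shift c g k (n - + 1)) (cong (qint· c g) (-‿comm n (+ 1) k)))

nthℤ : List ℤ → Coeffs
nthℤ xs (+ i)    = nth xs i
nthℤ xs -[1+ _ ] = + 0

coeff≡nthℤ : ∀ f n → coeff f n ≡ nthℤ (cs f) (n - low f)
coeff≡nthℤ f n with n - low f
... | + i      = refl
... | -[1+ _ ] = refl

nth-addL : ∀ xs ys i → nth (addL xs ys) i ≡ nth xs i + nth ys i
nth-addL []       ys       i       = sym (ℤP.+-identityˡ _)
nth-addL (x ∷ xs) []       i       = sym (ℤP.+-identityʳ _)
nth-addL (x ∷ xs) (y ∷ ys) zero    = refl
nth-addL (x ∷ xs) (y ∷ ys) (suc i) = nth-addL xs ys i

nthℤ-addL : ∀ xs ys → nthℤ (addL xs ys) ≗ nthℤ xs ⊕ nthℤ ys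
nthℤ-addL xs ys (+ i)    = nth-addL xs ys i
nthℤ-addL xs ys -[1+ _ ] = refl

nthℤ-padded : ∀ k xs → nthℤ (replicate k (+ 0) ++ xs) ≗ shift (+ k) (nthℤ xs)
nthℤ-padded zero    xs n        = cong (nthℤ xs) (sym (ℤP.+-identityʳ n))
nthℤ-padded (suc k) xs (+ zero) = refl
nthℤ-padded (suc k) xs +[1+ i ] = trans (nthℤ-padded k xs (+ i)) (cong (nthℤ xs) (reindex (+ i) (+ k)))
  where
  reindex : ∀ i k → i - k ≡ + 1 + i - (+ 1 + k)
  reindex = solve-∀
nthℤ-padded (suc k) xs -[1+ i ] = refl

nthℤ-map : ∀ (f : ℤ → ℤ) → f (+ 0) ≡ + 0 → ∀ xs n → nthℤ (List.map f xs) n ≡ f (nthℤ xs n)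
nthℤ-map f f0 xs       -[1+ _ ] = sym f0
nthℤ-map f f0 []       (+ i)    = sym f0
nthℤ-map f f0 (x ∷ xs) (+ zero) = refl
nthℤ-map f f0 (x ∷ xs) +[1+ i ] = nthℤ-map f f0 xs (+ i)

nthℤ-mulL-ones : ∀ c xs → nthℤ (mulL (replicate c (+ 1)) xs) ≗ qint· c (nthℤ xs)
nthℤ-mulL-ones zero    xs (+ i)    = refl
nthℤ-mulL-ones zero    xs -[1+ _ ] = refl
nthℤ-mulL-ones (suc c) xs n = begin
  nthℤ (addL (List.map (+ 1 *_) xs) (+ 0 ∷ mulL (replicate c (+ 1)) xs)) n
    ≡⟨ nthℤ-addL _ _ n ⟩
  nthℤ (List.map (+ 1 *_) xs) n + nthℤ (+ 0 ∷ mulL (replicate c (+ 1)) xs) n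
    ≡⟨ cong₂ _+_ (trans (nthℤ-map (+ 1 *_) refl xs n) (ℤP.*-identityˡ _)) (nthℤ-padded 1 _ n) ⟩
  nthℤ xs n + nthℤ (mulL (replicate c (+ 1)) xs) (n - + 1)
    ≡⟨ cong (_+_ (nthℤ xs n)) (nthℤ-mulL-ones c xs (n - + 1)) ⟩
  qint· (suc c) (nthℤ xs) n ∎
  where open ≡-Reasoning

coeff-+P : ∀ f g → coeff (f +P g) ≗ coeff f ⊕ coeff g
coeff-+P f g n = begin
  coeff (f +P g) n
    ≡⟨ coeff≡nthℤ (f +P g) n ⟩
  nthℤ (addL (padded f) (padded g)) (n - m)
    ≡⟨ nthℤ-addL (padded f) (padded g) (n - m) ⟩
  nthℤ (padded f) (n - m) + nthℤ (padded g) (n - m)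
    ≡⟨ cong₂ _+_ (aligned f (ℤP.i⊓j≤i (low f) (low g))) (aligned g (ℤP.i⊓j≤j (low f) (low g))) ⟩
  coeff f n + coeff g n ∎
  where
  open ≡-Reasoning
  m = low f ⊓ low g
  padded : LPoly → List ℤ
  padded h = replicate ∣ low h - m ∣ (+ 0) ++ cs h
  cancel : ∀ n m l → n - m - (l - m) ≡ n - l
  cancel = solve-∀
  aligned : ∀ h → m ≤ low h → nthℤ (padded h) (n - m) ≡ coeff h n
  aligned h m≤l = begin
    nthℤ (padded h) (n - m)
      ≡⟨ nthℤ-padded ∣ low h - m ∣ (cs h) (n - m) ⟩
    nthℤ (cs h) (n - m - + ∣ low h - m ∣)
      ≡⟨ cong (λ t → nthℤ (cs h) (n - m - t)) (ℤP.0≤i⇒+∣i∣≡i (ℤP.i≤j⇒0≤j-i m≤l)) ⟩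
    nthℤ (cs h) (n - m - (low h - m))
      ≡⟨ cong (nthℤ (cs h)) (cancel n m (low h)) ⟩
    nthℤ (cs h) (n - low h)
      ≡⟨ coeff≡nthℤ h n ⟨
    coeff h n ∎

coeff--P : ∀ f g → coeff (f -P g) ≗ coeff f ⊝ coeff g
coeff--P f g n = trans (coeff-+P f (-P g) n) (cong (_+_ (coeff f n)) negated)
  where
  negated : coeff (-P g) n ≡ - coeff g n
  negated = trans (coeff≡nthℤ (-P g) n)
                  (trans (nthℤ-map -_ refl (cs g) (n - low g)) (cong -_ (sym (coeff≡nthℤ g n))))

-- qint c and qpow k are both of the form ⟨ l , [1,…,1] ⟩
coeff-*P-ones : ∀ l c f → coeff (⟨ l , replicate c (+ 1) ⟩ *P f) ≗ shift l (qint· c (coeff f))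
coeff-*P-ones l c f n = begin
  coeff (⟨ l , replicate c (+ 1) ⟩ *P f) n
    ≡⟨ coeff≡nthℤ (⟨ l , replicate c (+ 1) ⟩ *P f) n ⟩
  nthℤ (mulL (replicate c (+ 1)) (cs f)) (n - (l + low f))
    ≡⟨ nthℤ-mulL-ones c (cs f) _ ⟩
  qint· c (nthℤ (cs f)) (n - (l + low f))
    ≡⟨ cong (qint· c (nthℤ (cs f))) (assoc n l (low f)) ⟩
  shift (low f) (qint· c (nthℤ (cs f))) (n - l)
    ≡⟨ qint·-shift c (nthℤ (cs f)) (low f) (n - l) ⟨
  qint· c (shift (low f) (nthℤ (cs f))) (n - l)
    ≡⟨ qint·-cong c (λ m → sym (coeff≡nthℤ f m)) (n - l) ⟩
  qint· c (coeff f) (n - l) ∎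
  where
  open ≡-Reasoning
  assoc : ∀ n l k → n - (l + k) ≡ n - l - k
  assoc = solve-∀

coeff-qint*P : ∀ c f → coeff (qint c *P f) ≗ qint· c (coeff f)
coeff-qint*P c f n = trans (coeff-*P-ones (+ 0) c f n) (cong (qint· c (coeff f)) (ℤP.+-identityʳ n))

coeff-qpow*P : ∀ k f → coeff (qpow k *P f) ≗ shift k (coeff f)
coeff-qpow*P k f n = trans (coeff-*P-ones k 1 f n) (ℤP.+-identityʳ _)

-- Reversal of coefficient lists

nth-zeros : ∀ {zs} → All (_≡ + 0) zs → ∀ i → nth zs i ≡ + 0
nth-zeros []         i       = refl
nth-zeros (z≡0 ∷ _)  zero    = z≡0
nth-zeros (_ ∷ zs≡0) (suc i) = nth-zeros zs≡0 i

zeros-from-nth : ∀ zs → (∀ i → nth zs i ≡ + 0) → All (_≡ + 0) zs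
zeros-from-nth []       _    = []
zeros-from-nth (z ∷ zs) all0 = all0 zero ∷ zeros-from-nth zs (λ i → all0 (suc i))

nth-++ˡ : ∀ p ys {i} → i ℕ.< length p → nth (p ++ ys) i ≡ nth p i
nth-++ˡ (x ∷ p) ys {zero}  _         = refl
nth-++ˡ (x ∷ p) ys {suc i} (s≤s i<l) = nth-++ˡ p ys i<l

nth-++ʳ : ∀ p ys i → nth (p ++ ys) (length p ℕ.+ i) ≡ nth ys i
nth-++ʳ []      ys i = refl
nth-++ʳ (x ∷ p) ys i = nth-++ʳ p ys i

nth-ʳ++ʳ : ∀ p ys i → nth (p ʳ++ ys) (length p ℕ.+ i) ≡ nth ys i
nth-ʳ++ʳ []      ys i = refl
nth-ʳ++ʳ (x ∷ p) ys i =
  trans (cong (nth (p ʳ++ x ∷ ys)) (sym (ℕP.+-suc (length p) i))) (nth-ʳ++ʳ p (x ∷ ys) (suc i))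

nth-ʳ++ˡ : ∀ p ys j k → length p ≡ suc (k ℕ.+ j) → nth (p ʳ++ ys) j ≡ nth p k
nth-ʳ++ˡ (x ∷ p) ys j zero    len =
  trans (cong (nth (p ʳ++ x ∷ ys)) (trans (sym (ℕP.suc-injective len)) (sym (ℕP.+-identityʳ _))))
        (nth-ʳ++ʳ p (x ∷ ys) 0)
nth-ʳ++ˡ (x ∷ p) ys j (suc k) len = nth-ʳ++ˡ p (x ∷ ys) j k (ℕP.suc-injective len)

dropZ-zeros : ∀ {zs} → All (_≡ + 0) zs → ∀ r → dropZ (zs ʳ++ r) ≡ dropZ r
dropZ-zeros []             r = refl
dropZ-zeros (refl ∷ zs≡0) r = dropZ-zeros zs≡0 (+ 0 ∷ r)

dropZ-nonzero : ∀ {x} r → x ≢ + 0 → dropZ (x ∷ r) ≡ x ∷ r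
dropZ-nonzero {+ zero}    r x≢0 = ⊥-elim (x≢0 refl)
dropZ-nonzero {+[1+ _ ]}  r x≢0 = refl
dropZ-nonzero { -[1+ _ ]} r x≢0 = refl

reverse-trimTop : ∀ p {x zs} → x ≢ + 0 → All (_≡ + 0) zs → reverse (trimTop (p ++ x ∷ zs)) ≡ x ∷ reverse p
reverse-trimTop p {x} {zs} x≢0 zs≡0 = begin
  reverse (reverse (dropZ (reverse (p ++ x ∷ zs))))  ≡⟨ ListP.reverse-involutive _ ⟩
  dropZ ((p ++ x ∷ zs) ʳ++ [])                        ≡⟨ cong dropZ (ListP.++-ʳ++ p) ⟩
  dropZ (zs ʳ++ x ∷ reverse p)                        ≡⟨ dropZ-zeros zs≡0 (x ∷ reverse p) ⟩
  dropZ (x ∷ reverse p)                               ≡⟨ dropZ-nonzero (reverse p) x≢0 ⟩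
  x ∷ reverse p                                       ∎
  where open ≡-Reasoning

nthℤ-reverse : ∀ p {x zs} → All (_≡ + 0) zs → ∀ n →
               nthℤ (x ∷ reverse p) n ≡ nthℤ (p ++ x ∷ zs) (+ length p - n)
nthℤ-reverse p {x} {zs} zs≡0 (+ zero) =
  sym (trans (cong (nthℤ (p ++ x ∷ zs)) (ℤP.+-identityʳ (+ length p)))
             (trans (cong (nth (p ++ x ∷ zs)) (sym (ℕP.+-identityʳ (length p)))) (nth-++ʳ p (x ∷ zs) 0)))
nthℤ-reverse p {x} {zs} zs≡0 +[1+ j ] with ℕP.<-≤-connex j (length p)
... | inj₁ j<l with ℕP.m≤n⇒∃[o]m+o≡n j<l
...   | k , j+1+k≡l = begin
  nth (p ʳ++ []) j                            ≡⟨ nth-ʳ++ˡ p [] j k (trans (sym j+1+k≡l) (cong suc (ℕP.+-comm j k))) ⟩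
  nth p k                                     ≡⟨ nth-++ˡ p (x ∷ zs) k<l ⟨
  nth (p ++ x ∷ zs) k                         ≡⟨ cong (nthℤ (p ++ x ∷ zs)) index ⟩
  nthℤ (p ++ x ∷ zs) (+ length p - +[1+ j ]) ∎
  where
  open ≡-Reasoning
  k<l : k ℕ.< length p
  k<l = subst (k ℕ.<_) j+1+k≡l (s≤s (ℕP.m≤n+m k j))
  cancel : ∀ a b → b ≡ a + b - a
  cancel = solve-∀
  index : + k ≡ + length p - +[1+ j ]
  index = trans (cancel +[1+ j ] (+ k)) (cong (λ l → + l - +[1+ j ]) j+1+k≡l)
nthℤ-reverse p {x} {zs} zs≡0 +[1+ j ] | inj₂ l≤j with ℕP.m≤n⇒∃[o]m+o≡n l≤j
...   | k , l+k≡j = begin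
  nth (p ʳ++ []) j                            ≡⟨ cong (nth (p ʳ++ [])) l+k≡j ⟨
  nth (p ʳ++ []) (length p ℕ.+ k)             ≡⟨ nth-ʳ++ʳ p [] k ⟩
  + 0                                         ≡⟨ cong (nthℤ (p ++ x ∷ zs)) index ⟨
  nthℤ (p ++ x ∷ zs) (+ length p - +[1+ j ]) ∎
  where
  open ≡-Reasoning
  below : ∀ l k → l - (+ 1 + (l + k)) ≡ - (+ 1 + k)
  below = solve-∀
  index : + length p - +[1+ j ] ≡ -[1+ k ]
  index = trans (cong (λ j → + length p - + suc j) (sym l+k≡j)) (below (+ length p) (+ k))
nthℤ-reverse p {x} {zs} zs≡0 -[1+ a ] = sym (trans (nth-++ʳ p (x ∷ zs) (suc a)) (nth-zeros zs≡0 a))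

record TopSplit (c : List ℤ) (t : ℕ) : Set where
  field
    init        : List ℤ
    top         : ℤ
    rest        : List ℤ
    split       : c ≡ init ++ top ∷ rest
    length-init : length init ≡ t
    top≢0       : top ≢ + 0
    rest≡0      : All (_≡ + 0) rest

splitAtTop : ∀ c t → nth c t ≢ + 0 → (∀ i → t ℕ.< i → nth c i ≡ + 0) → TopSplit c t
splitAtTop []      t       nonzero above = ⊥-elim (nonzero refl)
splitAtTop (x ∷ c) zero    nonzero above =
  record { init = [] ; top = x ; rest = c ; split = refl ; length-init = refl ; top≢0 = nonzero
         ; rest≡0 = zeros-from-nth c (λ i → above (suc i) (s≤s z≤n)) }
splitAtTop (x ∷ c) (suc t) nonzero above =
  record { init = x ∷ init ; top = top ; rest = rest ; split = cong (x ∷_) split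
         ; length-init = cong suc length-init ; top≢0 = top≢0 ; rest≡0 = rest≡0 }
  where open TopSplit (splitAtTop c t nonzero (λ i t<i → above (suc i) (s≤s t<i)))

splitAtDegree : ∀ f D t → D - low f ≡ + t → coeff f D ≢ + 0 → (∀ m → D ℤ.< m → coeff f m ≡ + 0) →
                TopSplit (cs f) t
splitAtDegree f D t eq nonzero above = splitAtTop (cs f) t top≢0 zero-above
  where
  shiftBack : ∀ a b → a ≡ a - b + b
  shiftBack = solve-∀
  cancel : ∀ a b → a ≡ a + b - b
  cancel = solve-∀
  top≢0 : nth (cs f) t ≢ + 0
  top≢0 e = nonzero (trans (coeff≡nthℤ f D) (trans (cong (nthℤ (cs f)) eq) e))
  D≡ : D ≡ + t + low f
  D≡ = trans (shiftBack D (low f)) (cong (_+ low f) eq)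
  t+l<i+l : ∀ {i} → t ℕ.< i → + t + low f ℤ.< + i + low f
  t+l<i+l t<i = ℤP.+-monoˡ-< (low f) (+<+ t<i)
  zero-above : ∀ i → t ℕ.< i → nth (cs f) i ≡ + 0
  zero-above i t<i = begin
    nthℤ (cs f) (+ i)                  ≡⟨ cong (nthℤ (cs f)) (cancel (+ i) (low f)) ⟩
    nthℤ (cs f) (+ i + low f - low f)  ≡⟨ coeff≡nthℤ f (+ i + low f) ⟨
    coeff f (+ i + low f)              ≡⟨ above _ (subst (ℤ._< + i + low f) (sym D≡) (t+l<i+l t<i)) ⟩
    + 0                                ∎
    where open ≡-Reasoning

coeff-vee : ∀ f D → coeff f D ≢ + 0 → (∀ m → D ℤ.< m → coeff f m ≡ + 0) →
            ∀ n → coeff (vee f) n ≡ coeff f (D - n)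
coeff-vee f D nonzero above n = reflected (D - low f) refl
  where
  reflected : ∀ u → D - low f ≡ u → coeff (vee f) n ≡ coeff f (D - n)
  reflected -[1+ _ ] eq = ⊥-elim (nonzero (trans (coeff≡nthℤ f D) (cong (nthℤ (cs f)) eq)))
  reflected (+ t)    eq = begin
    coeff (vee f) n
      ≡⟨ coeff≡nthℤ (vee f) n ⟩
    nthℤ (reverse (trimTop (cs f))) (n - + 0)
      ≡⟨ cong₂ (λ c m → nthℤ (reverse (trimTop c)) m) split (ℤP.+-identityʳ n) ⟩
    nthℤ (reverse (trimTop (init ++ top ∷ rest))) n
      ≡⟨ cong (λ c → nthℤ c n) (reverse-trimTop init top≢0 rest≡0) ⟩
    nthℤ (top ∷ reverse init) n
      ≡⟨ nthℤ-reverse init rest≡0 n ⟩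
    nthℤ (init ++ top ∷ rest) (+ length init - n)
      ≡⟨ cong₂ (λ c l → nthℤ c (+ l - n)) split (sym length-init) ⟨
    nthℤ (cs f) (+ t - n)
      ≡⟨ cong (nthℤ (cs f)) (trans (cong (_- n) (sym eq)) (-‿comm D (low f) n)) ⟩
    nthℤ (cs f) (D - n - low f)
      ≡⟨ coeff≡nthℤ f (D - n) ⟨
    coeff f (D - n) ∎
    where
    open ≡-Reasoning
    open TopSplit (splitAtDegree f D t eq nonzero above)

-- The q-deformed Stern–Brocot matrices

Pair : Set
Pair = Coeffs × Coeffs

infix 4 _≋_
_≋_ : Pair → Pair → Set
_≋_ = Pointwise _≗_ _≗_

≋-refl : ∀ {v} → v ≋ v
≋-refl = (λ _ → refl) , (λ _ → refl)

≋-sym : ∀ {u v} → u ≋ v → v ≋ u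
≋-sym (p , q) = (λ n → sym (p n)) , (λ n → sym (q n))

≋-trans : ∀ {u v w} → u ≋ v → v ≋ w → u ≋ w
≋-trans (p , q) (p′ , q′) = (λ n → trans (p n) (p′ n)) , (λ n → trans (q n) (q′ n))

≡⇒≋ : ∀ {u v} → u ≡ v → u ≋ v
≡⇒≋ refl = ≋-refl

≋-setoid : Setoid _ _
≋-setoid = record
  { Carrier = Pair ; _≈_ = _≋_
  ; isEquivalence = record { refl = ≋-refl ; sym = ≋-sym ; trans = ≋-trans } }

module ≋-Reasoning = SetoidReasoning ≋-setoid

unit 0ᶜ : Coeffs
unit (+ zero) = + 1
unit +[1+ _ ] = + 0
unit -[1+ _ ] = + 0
0ᶜ _ = + 0

reflect : Coeffs → Coeffs
reflect f n = f (- n)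

reflect-unit : reflect unit ≗ unit
reflect-unit (+ zero) = refl
reflect-unit +[1+ _ ] = refl
reflect-unit -[1+ _ ] = refl

shiftᵖ : ℤ → Pair → Pair
shiftᵖ k (r , s) = shift k r , shift k s

_⊕ᵖ_ : Pair → Pair → Pair
(r , s) ⊕ᵖ (r′ , s′) = r ⊕ r′ , s ⊕ s′

mirror : Pair → Pair
mirror (r , s) = reflect s , reflect r

e₁ e₂ 𝟙 : Pair
e₁ = unit , 0ᶜ
e₂ = 0ᶜ , unit
𝟙  = unit , unit

shiftᵖ-cong : ∀ k {u v} → u ≋ v → shiftᵖ k u ≋ shiftᵖ k v
shiftᵖ-cong k (p , q) = (λ n → p _) , (λ n → q _)

shiftᵖ-index : ∀ {j k} v → j ≡ k → shiftᵖ j v ≋ shiftᵖ k v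
shiftᵖ-index v refl = ≋-refl

shiftᵖ-zero : ∀ v → shiftᵖ (+ 0) v ≋ v
shiftᵖ-zero (r , s) = (λ n → cong r (ℤP.+-identityʳ n)) , (λ n → cong s (ℤP.+-identityʳ n))

shiftᵖ-shiftᵖ : ∀ j k v → shiftᵖ j (shiftᵖ k v) ≋ shiftᵖ (j + k) v
shiftᵖ-shiftᵖ j k (r , s) = (λ n → cong r (assoc n j k)) , (λ n → cong s (assoc n j k))
  where
  assoc : ∀ n j k → n - j - k ≡ n - (j + k)
  assoc = solve-∀

mirror-cong : ∀ {u v} → u ≋ v → mirror u ≋ mirror v
mirror-cong (p , q) = (λ n → q _) , (λ n → p _)

mirror-involutive : ∀ v → mirror (mirror v) ≋ v
mirror-involutive (r , s) = (λ n → cong r (ℤP.neg-involutive n)) , (λ n → cong s (ℤP.neg-involutive n))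

data Letter : Set where
  R L : Letter

Word : Set
Word = List Letter

-- q-analogues of R = (1 1; 0 1) and L = (1 0; 1 1) acting on column vectors
qact : Letter → Pair → Pair
qact R (r , s) = shift (+ 1) r ⊕ s , s
qact L (r , s) = shift (+ 1) r , shift (+ 1) r ⊕ s

qrun : Word → Pair → Pair
qrun w v = List.foldr qact v w

qfrac : Word → Pair
qfrac w = qrun w 𝟙

flipLetter : Letter → Letter
flipLetter R = L
flipLetter L = R

flipWord : Word → Word
flipWord = List.map flipLetter

qact-cong : ∀ x {u v} → u ≋ v → qact x u ≋ qact x v
qact-cong R (p , q) = (λ n → cong₂ _+_ (p _) (q n)) , q
qact-cong L (p , q) = (λ n → p _) , (λ n → cong₂ _+_ (p _) (q n))

qrun-cong : ∀ w {u v} → u ≋ v → qrun w u ≋ qrun w v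
qrun-cong []      e = e
qrun-cong (x ∷ w) e = qact-cong x (qrun-cong w e)

qrun-++ : ∀ w w′ v → qrun (w ++ w′) v ≡ qrun w (qrun w′ v)
qrun-++ w w′ v = ListP.foldr-++ qact v w w′

qact-shiftᵖ : ∀ x k v → qact x (shiftᵖ k v) ≋ shiftᵖ k (qact x v)
qact-shiftᵖ R k (r , s) = (λ n → cong (_+ s (n - k)) (cong r (-‿comm n (+ 1) k))) , (λ n → refl)
qact-shiftᵖ L k (r , s) =
  (λ n → cong r (-‿comm n (+ 1) k)) , (λ n → cong (_+ s (n - k)) (cong r (-‿comm n (+ 1) k)))

qrun-shiftᵖ : ∀ w k v → qrun w (shiftᵖ k v) ≋ shiftᵖ k (qrun w v)
qrun-shiftᵖ []      k v = ≋-refl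
qrun-shiftᵖ (x ∷ w) k v = ≋-trans (qact-cong x (qrun-shiftᵖ w k v)) (qact-shiftᵖ x k (qrun w v))

qact-⊕ᵖ : ∀ x u v → qact x (u ⊕ᵖ v) ≋ qact x u ⊕ᵖ qact x v
qact-⊕ᵖ R (r , s) (r′ , s′) = (λ n → ℤ+.interchange (r (n - + 1)) (r′ (n - + 1)) (s n) (s′ n)) , (λ n → refl)
qact-⊕ᵖ L (r , s) (r′ , s′) = (λ n → refl) , (λ n → ℤ+.interchange (r (n - + 1)) (r′ (n - + 1)) (s n) (s′ n))

qrun-⊕ᵖ : ∀ w u v → qrun w (u ⊕ᵖ v) ≋ qrun w u ⊕ᵖ qrun w v
qrun-⊕ᵖ []      u v = ≋-refl
qrun-⊕ᵖ (x ∷ w) u v = ≋-trans (qact-cong x (qrun-⊕ᵖ w u v)) (qact-⊕ᵖ x (qrun w u) (qrun w v))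

qfrac-columns : ∀ w → qfrac w ≋ qrun w e₁ ⊕ᵖ qrun w e₂
qfrac-columns w = ≋-trans (qrun-cong w 𝟙≋e₁⊕e₂) (qrun-⊕ᵖ w e₁ e₂)
  where
  𝟙≋e₁⊕e₂ : 𝟙 ≋ e₁ ⊕ᵖ e₂
  𝟙≋e₁⊕e₂ = (λ n → sym (ℤP.+-identityʳ (unit n))) , (λ n → sym (ℤP.+-identityˡ (unit n)))

private
  mirror-index : ∀ n → - n ≡ - (n - + 1) - + 1
  mirror-index = solve-∀

  mirror-swap : ∀ (r s : Coeffs) n → s (- (n - + 1)) + r (- n) ≡ r (- (n - + 1) - + 1) + s (- (n - + 1))
  mirror-swap r s n =
    trans (ℤP.+-comm (s (- (n - + 1))) (r (- n))) (cong (_+ s (- (n - + 1))) (cong r (mirror-index n)))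

qact-mirror : ∀ x v → qact (flipLetter x) (mirror v) ≋ shiftᵖ (+ 1) (mirror (qact x v))
qact-mirror R (r , s) = (λ n → refl) , (λ n → mirror-swap r s n)
qact-mirror L (r , s) = (λ n → mirror-swap r s n) , (λ n → cong r (mirror-index n))

qrun-flipWord : ∀ w v → qrun (flipWord w) v ≋ shiftᵖ (+ length w) (mirror (qrun w (mirror v)))
qrun-flipWord []      v = ≋-sym (≋-trans (shiftᵖ-zero _) (mirror-involutive v))
qrun-flipWord (x ∷ w) v = begin
  qact (flipLetter x) (qrun (flipWord w) v)
    ≈⟨ qact-cong (flipLetter x) (qrun-flipWord w v) ⟩
  qact (flipLetter x) (shiftᵖ (+ length w) (mirror Y))
    ≈⟨ qact-shiftᵖ (flipLetter x) (+ length w) (mirror Y) ⟩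
  shiftᵖ (+ length w) (qact (flipLetter x) (mirror Y))
    ≈⟨ shiftᵖ-cong (+ length w) (qact-mirror x Y) ⟩
  shiftᵖ (+ length w) (shiftᵖ (+ 1) (mirror (qact x Y)))
    ≈⟨ shiftᵖ-shiftᵖ (+ length w) (+ 1) (mirror (qact x Y)) ⟩
  shiftᵖ (+ length w + + 1) (mirror (qact x Y))
    ≈⟨ shiftᵖ-index (mirror (qact x Y)) (ℤP.+-comm (+ length w) (+ 1)) ⟩
  shiftᵖ (+ length (x ∷ w)) (mirror (qact x Y)) ∎
  where
  open ≋-Reasoning
  Y = qrun w (mirror v)

qfrac-flipWord : ∀ w → qfrac (flipWord w) ≋ shiftᵖ (+ length w) (mirror (qfrac w))
qfrac-flipWord w =
  ≋-trans (qrun-flipWord w 𝟙) (shiftᵖ-cong (+ length w) (mirror-cong (qrun-cong w (reflect-unit , reflect-unit))))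

Columns : Set
Columns = Pair × Pair

infix 4 _≋²_
_≋²_ : Columns → Columns → Set
_≋²_ = Pointwise _≋_ _≋_

≋²-trans : ∀ {A B C} → A ≋² B → B ≋² C → A ≋² C
≋²-trans (p , q) (p′ , q′) = ≋-trans p p′ , ≋-trans q q′

≋²-sym : ∀ {A B} → A ≋² B → B ≋² A
≋²-sym (p , q) = ≋-sym p , ≋-sym q

≡⇒≋² : ∀ {A B} → A ≡ B → A ≋² B
≡⇒≋² refl = ≋-refl , ≋-refl

qcolumns : Word → Columns
qcolumns w = qrun w e₁ , qrun w e₂

-- multiplication by the matrix of a letter on the right
qactʳ : Letter → Columns → Columns
qactʳ R (C₁ , C₂) = shiftᵖ (+ 1) C₁ , C₁ ⊕ᵖ C₂
qactʳ L (C₁ , C₂) = shiftᵖ (+ 1) (C₁ ⊕ᵖ C₂) , C₂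

qactʳ-cong : ∀ x {A B} → A ≋² B → qactʳ x A ≋² qactʳ x B
qactʳ-cong R ((p , q) , (p′ , q′)) =
  shiftᵖ-cong (+ 1) (p , q) , ((λ n → cong₂ _+_ (p n) (p′ n)) , (λ n → cong₂ _+_ (q n) (q′ n)))
qactʳ-cong L ((p , q) , (p′ , q′)) =
  shiftᵖ-cong (+ 1) ((λ n → cong₂ _+_ (p n) (p′ n)) , (λ n → cong₂ _+_ (q n) (q′ n))) , (p′ , q′)

qact-on-e : ∀ x → (qact x e₁ , qact x e₂) ≋² qactʳ x (e₁ , e₂)
qact-on-e R =
  ((λ n → ℤP.+-identityʳ _) , (λ n → refl)) ,
  ((λ n → trans (ℤP.+-identityˡ (unit n)) (sym (ℤP.+-identityʳ (unit n)))) , (λ n → sym (ℤP.+-identityˡ (unit n))))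
qact-on-e L =
  ((λ n → sym (ℤP.+-identityʳ (unit (n - + 1)))) ,
   (λ n → trans (ℤP.+-identityʳ (unit (n - + 1))) (sym (ℤP.+-identityˡ (unit (n - + 1)))))) ,
  ((λ n → refl) , (λ n → ℤP.+-identityˡ (unit n)))

qcolumns-∷ʳ : ∀ w x → qcolumns (w List.∷ʳ x) ≋² qactʳ x (qcolumns w)
qcolumns-∷ʳ w x = ≋²-trans (≡⇒≋ (qrun-++ w (x ∷ []) e₁) , ≡⇒≋ (qrun-++ w (x ∷ []) e₂)) (on-qact-e x)
  where
  on-qact-e : ∀ x → (qrun w (qact x e₁) , qrun w (qact x e₂)) ≋² qactʳ x (qcolumns w)
  on-qact-e R =
    ≋-trans (qrun-cong w (proj₁ (qact-on-e R))) (qrun-shiftᵖ w (+ 1) e₁) ,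
    ≋-trans (qrun-cong w (proj₂ (qact-on-e R))) (qrun-⊕ᵖ w e₁ e₂)
  on-qact-e L =
    ≋-trans (qrun-cong w (proj₁ (qact-on-e L)))
            (≋-trans (qrun-shiftᵖ w (+ 1) (e₁ ⊕ᵖ e₂)) (shiftᵖ-cong (+ 1) (qrun-⊕ᵖ w e₁ e₂))) ,
    qrun-cong w (proj₂ (qact-on-e L))

-- the q-analogue of (a b; c d) ↦ (d b; c a), which reverses products of R and L
reversed : ℕ → Columns → Columns
reversed k ((a , c) , (b , d)) =
  ((λ n → d (+ k - n)) , (λ n → c (+ suc k - n))) ,
  ((λ n → b (+ k - + 1 - n)) , (λ n → a (+ k - n)))

private
  +-cross : ∀ {a b c d : ℤ} → a ≡ d → b ≡ c → a + b ≡ c + d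
  +-cross {c = c} {d} a≡d b≡c = trans (cong₂ _+_ a≡d b≡c) (ℤP.+-comm d c)

reversed-qact : ∀ x k C₁ C₂ → reversed (suc k) (qact x C₁ , qact x C₂) ≋² qactʳ x (reversed k (C₁ , C₂))
reversed-qact R k (a , c) (b , d) =
  ((λ n → cong d (i₁ (+ k) n)) , (λ n → cong c (i₂ (+ k) n))) ,
  ((λ n → +-cross (cong b (i₄ (+ k) n)) (cong d (i₃ (+ k) n))) , (λ n → +-cross (cong a (i₅ (+ k) n)) refl))
  where
  i₁ : ∀ k n → + 1 + k - n ≡ k - (n - + 1)
  i₁ = solve-∀
  i₂ : ∀ k n → + 1 + (+ 1 + k) - n ≡ + 1 + k - (n - + 1)
  i₂ = solve-∀
  i₃ : ∀ k n → + 1 + k - + 1 - n ≡ k - n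
  i₃ = solve-∀
  i₄ : ∀ k n → + 1 + k - + 1 - n - + 1 ≡ k - + 1 - n
  i₄ = solve-∀
  i₅ : ∀ k n → + 1 + k - n - + 1 ≡ k - n
  i₅ = solve-∀
reversed-qact L k (a , c) (b , d) =
  ((λ n → +-cross (cong b (i₂ (+ k) n)) (cong d (i₁ (+ k) n))) ,
   (λ n → +-cross (cong a (i₄ (+ k) n)) (cong c (i₃ (+ k) n)))) ,
  ((λ n → cong b (i₅ (+ k) n)) , (λ n → cong a (i₆ (+ k) n)))
  where
  i₁ : ∀ k n → + 1 + k - n ≡ k - (n - + 1)
  i₁ = solve-∀
  i₂ : ∀ k n → + 1 + k - n - + 1 ≡ k - + 1 - (n - + 1)
  i₂ = solve-∀
  i₃ : ∀ k n → + 1 + (+ 1 + k) - n ≡ + 1 + k - (n - + 1)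
  i₃ = solve-∀
  i₄ : ∀ k n → + 1 + (+ 1 + k) - n - + 1 ≡ k - (n - + 1)
  i₄ = solve-∀
  i₅ : ∀ k n → + 1 + k - + 1 - n - + 1 ≡ k - + 1 - n
  i₅ = solve-∀
  i₆ : ∀ k n → + 1 + k - n - + 1 ≡ k - n
  i₆ = solve-∀

qcolumns-reverse : ∀ u → qcolumns (reverse u) ≋² reversed (length u) (qcolumns u)
qcolumns-reverse [] =
  ((λ n → sym (trans (cong unit (ℤP.+-identityˡ (- n))) (reflect-unit n))) , (λ n → refl)) ,
  ((λ n → refl) , (λ n → sym (trans (cong unit (ℤP.+-identityˡ (- n))) (reflect-unit n))))
qcolumns-reverse (x ∷ u) =
  ≋²-trans (≡⇒≋² (cong qcolumns (ListP.unfold-reverse x u)))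
  (≋²-trans (qcolumns-∷ʳ (reverse u) x)
  (≋²-trans (qactʳ-cong x (qcolumns-reverse u))
            (≋²-sym (reversed-qact x (length u) (qrun u e₁) (qrun u e₂)))))

record Degree (k : ℕ) (v : Pair) : Set where
  field
    r-above : ∀ m → + k ℤ.< m → proj₁ v m ≡ + 0
    r-top   : proj₁ v (+ k) ≡ + 1
    s-above : ∀ m → + k ℤ.< m → proj₂ v m ≡ + 0

private
  <-pred : ∀ {k m} → + suc k ℤ.< m → + k ℤ.< m - + 1
  <-pred = ℤP.+-monoˡ-< (- + 1)

  <-weaken : ∀ {k m} → + suc k ℤ.< m → + k ℤ.< m
  <-weaken {k} = ℤP.<-trans (+<+ (ℕP.n<1+n k))

qfrac-degree : ∀ w → Degree (length w) (qfrac w)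
qfrac-degree []      = record { r-above = unit-above ; r-top = refl ; s-above = unit-above }
  where
  unit-above : ∀ m → + 0 ℤ.< m → unit m ≡ + 0
  unit-above +[1+ _ ] _        = refl
  unit-above (+ zero) (+<+ ())
qfrac-degree (R ∷ w) = record
  { r-above = λ m k+1<m → cong₂ _+_ (r-above _ (<-pred k+1<m)) (s-above m (<-weaken k+1<m))
  ; r-top   = cong₂ _+_ r-top (s-above _ (+<+ (ℕP.n<1+n _)))
  ; s-above = λ m k+1<m → s-above m (<-weaken k+1<m) }
  where open Degree (qfrac-degree w)
qfrac-degree (L ∷ w) = record
  { r-above = λ m k+1<m → r-above _ (<-pred k+1<m)
  ; r-top   = r-top
  ; s-above = λ m k+1<m → cong₂ _+_ (r-above _ (<-pred k+1<m)) (s-above m (<-weaken k+1<m)) }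
  where open Degree (qfrac-degree w)

qfrac-L-top : ∀ u → proj₂ (qfrac (L ∷ u)) (+ suc (length u)) ≡ + 1
qfrac-L-top u = cong₂ _+_ r-top (s-above _ (+<+ (ℕP.n<1+n _)))
  where open Degree (qfrac-degree u)

𝓡ʷ 𝓢ʷ : Word → Coeffs
𝓡ʷ w = proj₁ (qfrac w)
𝓢ʷ w = proj₂ (qfrac w)

𝓡ʷ-L : ∀ v n → 𝓡ʷ (L ∷ v) n ≡ 𝓡ʷ (R ∷ v) n - 𝓢ʷ (R ∷ v) n
𝓡ʷ-L v n = sym (cancel (𝓡ʷ v (n - + 1)) (𝓢ʷ v n))
  where
  cancel : ∀ a b → a + b - b ≡ a
  cancel = solve-∀

module _ (u : Word) where

  private
    k D : ℤ
    k = + length u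
    D = + suc (length u)
    a c b d : Coeffs
    a = proj₁ (qrun u e₁)
    c = proj₂ (qrun u e₁)
    b = proj₁ (qrun u e₂)
    d = proj₂ (qrun u e₂)
    rev = qcolumns-reverse u

  𝓡ʷ-reverse : ∀ m → 𝓡ʷ (reverse u) m ≡ d (k - m) + b (k - + 1 - m)
  𝓡ʷ-reverse m = trans (proj₁ (qfrac-columns (reverse u)) m) (cong₂ _+_ (proj₁ (proj₁ rev) m) (proj₁ (proj₂ rev) m))

  𝓢ʷ-reverse : ∀ m → 𝓢ʷ (reverse u) m ≡ c (+ 1 + k - m) + a (k - m)
  𝓢ʷ-reverse m = trans (proj₂ (qfrac-columns (reverse u)) m) (cong₂ _+_ (proj₂ (proj₁ rev) m) (proj₂ (proj₂ rev) m))

  𝓢ʷ-L∷flip : ∀ n → 𝓢ʷ (L ∷ flipWord u) n ≡ 𝓢ʷ (L ∷ u) (D - n)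
  𝓢ʷ-L∷flip n = trans (proj₁ (qfrac-flipWord (L ∷ u)) n) (cong (𝓢ʷ (L ∷ u)) (index n D))
    where
    index : ∀ n D → - (n - D) ≡ D - n
    index = solve-∀

  𝓢ʷ-L∷reverse : ∀ n → 𝓢ʷ (L ∷ reverse u) n ≡ 𝓢ʷ (L ∷ u) (D - n)
  𝓢ʷ-L∷reverse n = begin
    𝓡ʷ (reverse u) (n - + 1) + 𝓢ʷ (reverse u) n
      ≡⟨ cong₂ _+_ (𝓡ʷ-reverse (n - + 1)) (𝓢ʷ-reverse n) ⟩
    (d (k - (n - + 1)) + b (k - + 1 - (n - + 1))) + (c (+ 1 + k - n) + a (k - n))
      ≡⟨ cong₂ _+_ (cong₂ _+_ (cong d (i₁ k n)) (cong b (i₂ k n))) (cong (_+_ (c (D - n))) (cong a (i₃ k n))) ⟩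
    (d (D - n) + b (D - n - + 1)) + (c (D - n) + a (D - n - + 1))
      ≡⟨ regroup (d (D - n)) (b (D - n - + 1)) (c (D - n)) (a (D - n - + 1)) ⟩
    (a (D - n - + 1) + b (D - n - + 1)) + (c (D - n) + d (D - n))
      ≡⟨ cong₂ _+_ (proj₁ (qfrac-columns u) (D - n - + 1)) (proj₂ (qfrac-columns u) (D - n)) ⟨
    𝓢ʷ (L ∷ u) (D - n) ∎
    where
    open ≡-Reasoning
    i₁ : ∀ k n → k - (n - + 1) ≡ + 1 + k - n
    i₁ = solve-∀
    i₂ : ∀ k n → k - + 1 - (n - + 1) ≡ + 1 + k - n - + 1
    i₂ = solve-∀
    i₃ : ∀ k n → k - n ≡ + 1 + k - n - + 1
    i₃ = solve-∀
    regroup : ∀ p q r s → (p + q) + (r + s) ≡ (s + q) + (r + p)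
    regroup = solve-∀

  𝓡ʷ-L∷reverse : ∀ n → 𝓡ʷ (L ∷ reverse u) n ≡ 𝓡ʷ (flipWord (L ∷ u)) n - proj₁ (qrun (flipWord (L ∷ u)) e₂) n
  𝓡ʷ-L∷reverse n = sym (begin
    𝓡ʷ (flipWord (L ∷ u)) n - proj₁ (qrun (flipWord (L ∷ u)) e₂) n
      ≡⟨ cong₂ _-_ (proj₁ (qfrac-flipWord (L ∷ u)) n) (trans (proj₁ (qrun-flipWord (L ∷ u) e₂) n) mirror-e₂) ⟩
    𝓢ʷ (L ∷ u) T - proj₂ (qrun (L ∷ u) e₁) T
      ≡⟨ cong (_- proj₂ (qrun (L ∷ u) e₁) T)
              (cong₂ _+_ (proj₁ (qfrac-columns u) (T - + 1)) (proj₂ (qfrac-columns u) T)) ⟩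
    (a (T - + 1) + b (T - + 1)) + (c T + d T) - (a (T - + 1) + c T)
      ≡⟨ cancel (a (T - + 1)) (b (T - + 1)) (c T) (d T) ⟩
    b (T - + 1) + d T
      ≡⟨ +-cross (cong b (i₁ k n)) (cong d (i₂ k n)) ⟩
    d (k - (n - + 1)) + b (k - + 1 - (n - + 1))
      ≡⟨ 𝓡ʷ-reverse (n - + 1) ⟨
    𝓡ʷ (L ∷ reverse u) n ∎)
    where
    open ≡-Reasoning
    T = - (n - D)
    mirror-e₂ : proj₂ (qrun (L ∷ u) (mirror e₂)) T ≡ proj₂ (qrun (L ∷ u) e₁) T
    mirror-e₂ = proj₂ (qrun-cong (L ∷ u) (reflect-unit , (λ _ → refl))) T
    cancel : ∀ p q r s → (p + q) + (r + s) - (p + r) ≡ q + s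
    cancel = solve-∀
    i₁ : ∀ k n → - (n - (+ 1 + k)) - + 1 ≡ k - + 1 - (n - + 1)
    i₁ = solve-∀
    i₂ : ∀ k n → - (n - (+ 1 + k)) ≡ k - (n - + 1)
    i₂ = solve-∀

-- Stern–Brocot words over ℕ

act : Letter → ℕ × ℕ → ℕ × ℕ
act R (n , d) = n ℕ.+ d , d
act L (n , d) = n , n ℕ.+ d

run : Word → ℕ × ℕ → ℕ × ℕ
run w v = List.foldr act v w

frac : Word → ℕ × ℕ
frac w = run w (1 , 1)

run-++ : ∀ w w′ v → run (w ++ w′) v ≡ run w (run w′ v)
run-++ w w′ v = ListP.foldr-++ act v w w′

infixl 6 _+²_
_+²_ : ℕ × ℕ → ℕ × ℕ → ℕ × ℕ
(a , b) +² (c , d) = a ℕ.+ c , b ℕ.+ d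

act-+² : ∀ x u v → act x (u +² v) ≡ act x u +² act x v
act-+² R (a , b) (c , d) = cong (_, b ℕ.+ d) (ℕ+.interchange a c b d)
act-+² L (a , b) (c , d) = cong (a ℕ.+ c ,_) (ℕ+.interchange a c b d)

run-+² : ∀ w u v → run w (u +² v) ≡ run w u +² run w v
run-+² []      u v = refl
run-+² (x ∷ w) u v = trans (cong (act x) (run-+² w u v)) (act-+² x (run w u) (run w v))

frac-columns : ∀ w → frac w ≡ run w (1 , 0) +² run w (0 , 1)
frac-columns w = run-+² w (1 , 0) (0 , 1)

run-flipWord : ∀ w v → run (flipWord w) (swap v) ≡ swap (run w v)
run-flipWord []      v = refl
run-flipWord (R ∷ w) v rewrite run-flipWord w v = cong (proj₂ (run w v) ,_) (ℕP.+-comm (proj₂ (run w v)) _)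
run-flipWord (L ∷ w) v rewrite run-flipWord w v = cong (_, proj₁ (run w v)) (ℕP.+-comm (proj₂ (run w v)) _)

run-reverse : ∀ u → run (reverse u) (1 , 0) ≡ (proj₂ (run u (0 , 1)) , proj₂ (run u (1 , 0)))
                  × run (reverse u) (0 , 1) ≡ (proj₁ (run u (0 , 1)) , proj₁ (run u (1 , 0)))
run-reverse []      = refl , refl
run-reverse (x ∷ u) = trans (snoc (1 , 0)) (first x) , trans (snoc (0 , 1)) (second x)
  where
  p = run u (1 , 0)
  q = run u (0 , 1)
  col₁ = proj₁ (run-reverse u)
  col₂ = proj₂ (run-reverse u)
  snoc : ∀ v → run (reverse (x ∷ u)) v ≡ run (reverse u) (act x v)
  snoc v = trans (cong (λ w → run w v) (ListP.unfold-reverse x u)) (run-++ (reverse u) (x ∷ []) v)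
  sum : run (reverse u) (1 , 1) ≡ (proj₁ q ℕ.+ proj₂ q , proj₁ p ℕ.+ proj₂ p)
  sum = trans (frac-columns (reverse u))
              (trans (cong₂ _+²_ col₁ col₂) (cong₂ _,_ (ℕP.+-comm (proj₂ q) _) (ℕP.+-comm (proj₂ p) _)))
  first : ∀ x → run (reverse u) (act x (1 , 0)) ≡ (proj₂ (run (x ∷ u) (0 , 1)) , proj₂ (run (x ∷ u) (1 , 0)))
  first R = col₁
  first L = sum
  second : ∀ x → run (reverse u) (act x (0 , 1)) ≡ (proj₁ (run (x ∷ u) (0 , 1)) , proj₁ (run (x ∷ u) (1 , 0)))
  second R = sum
  second L = col₂

frac-positive : ∀ w → 0 ℕ.< proj₁ (frac w) × 0 ℕ.< proj₂ (frac w)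
frac-positive []      = s≤s z≤n , s≤s z≤n
frac-positive (R ∷ w) = ℕP.<-≤-trans (proj₁ (frac-positive w)) (ℕP.m≤m+n _ _) , proj₂ (frac-positive w)
frac-positive (L ∷ w) = proj₁ (frac-positive w) , ℕP.<-≤-trans (proj₁ (frac-positive w)) (ℕP.m≤m+n _ _)

frac-coprime : ∀ w → Coprime (proj₁ (frac w)) (proj₂ (frac w))
frac-coprime []      = Coprimality.1-coprimeTo 1
frac-coprime (R ∷ w) =
  subst (λ n → Coprime n (proj₂ (frac w))) (ℕP.+-comm (proj₂ (frac w)) _) (Coprimality.coprime-+ (frac-coprime w))
frac-coprime (L ∷ w) = Coprimality.sym (Coprimality.coprime-+ (Coprimality.sym (frac-coprime w)))

private
  unimodular-positive : ∀ a y {m} → a ℕ.* y ≡ suc m → 0 ℕ.< a × 0 ℕ.< y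
  unimodular-positive zero    y       ()
  unimodular-positive (suc a) zero    eq = ⊥-elim (ℕP.1+n≢0 (trans (sym eq) (ℕP.*-zeroʳ a)))
  unimodular-positive (suc a) (suc y) eq = s≤s z≤n , s≤s z≤n

unimodular-cases : ∀ {y b x a} → a ℕ.* y ≡ suc (b ℕ.* x) →
                   (b ≡ 0 × x ≡ 0) ⊎ (b ℕ.≤ y × a ℕ.≤ x) ⊎ (y ℕ.≤ b × x ℕ.≤ a)
unimodular-cases {y} {b} {x} {a} det with ℕP.≤-<-connex b y
... | inj₂ y<b = inj₂ (inj₂ (ℕP.<⇒≤ y<b , ℕP.≮⇒≥ (λ a<x → ℕP.m+1+n≰m (b ℕ.* x) (too-big y<b a<x))))
  where
  expand : ∀ y a → suc y ℕ.* suc a ≡ a ℕ.* y ℕ.+ suc (a ℕ.+ y)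
  expand = ℕ-Solver.solve-∀
  too-big : y ℕ.< b → a ℕ.< x → b ℕ.* x ℕ.+ suc (suc (a ℕ.+ y)) ℕ.≤ b ℕ.* x
  too-big y<b a<x = subst (ℕ._≤ b ℕ.* x)
    (trans (expand y a) (trans (cong (ℕ._+ suc (a ℕ.+ y)) det) (sym (ℕP.+-suc (b ℕ.* x) _))))
    (ℕP.*-mono-≤ y<b a<x)
... | inj₁ b≤y with ℕP.≤-<-connex a x
...   | inj₁ a≤x = inj₂ (inj₁ (b≤y , a≤x))
...   | inj₂ x<a with ℕP.m≤n⇒m<n∨m≡n b≤y
...     | inj₂ b≡y = inj₂ (inj₂ (ℕP.≤-reflexive (sym b≡y) , ℕP.<⇒≤ x<a))
...     | inj₁ b<y = inj₁ (ℕP.m+n≡0⇒m≡0 b b+x≡0 , ℕP.m+n≡0⇒n≡0 b b+x≡0)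
  where
  expand : ∀ b x → suc b ℕ.* suc x ≡ suc (b ℕ.* x ℕ.+ (b ℕ.+ x))
  expand = ℕ-Solver.solve-∀
  squeeze : b ℕ.* x ℕ.+ (b ℕ.+ x) ℕ.≤ b ℕ.* x ℕ.+ 0
  squeeze = ℕP.≤-pred (subst₂ ℕ._≤_ (expand b x) (cong suc (sym (ℕP.+-identityʳ _)))
              (subst (suc b ℕ.* suc x ℕ.≤_) (trans (ℕP.*-comm y a) det) (ℕP.*-mono-≤ b<y x<a)))
  b+x≡0 : b ℕ.+ x ≡ 0
  b+x≡0 = ℕP.n≤0⇒n≡0 (ℕP.+-cancelˡ-≤ (b ℕ.* x) _ _ squeeze)

unimodular-R⁻¹ : ∀ {y b x a} → a ℕ.* (b ℕ.+ y) ≡ suc (b ℕ.* (a ℕ.+ x)) → a ℕ.* y ≡ suc (b ℕ.* x)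
unimodular-R⁻¹ {y} {b} {x} {a} det =
  ℕP.+-cancelˡ-≡ (a ℕ.* b) _ _ (trans (sym (expandˡ a b y)) (trans det (expandʳ a b x)))
  where
  expandˡ : ∀ a b y → a ℕ.* (b ℕ.+ y) ≡ a ℕ.* b ℕ.+ a ℕ.* y
  expandˡ = ℕ-Solver.solve-∀
  expandʳ : ∀ a b x → suc (b ℕ.* (a ℕ.+ x)) ≡ a ℕ.* b ℕ.+ suc (b ℕ.* x)
  expandʳ = ℕ-Solver.solve-∀

unimodular-L⁻¹ : ∀ {y b x a} → (x ℕ.+ a) ℕ.* y ≡ suc ((y ℕ.+ b) ℕ.* x) → a ℕ.* y ≡ suc (b ℕ.* x)
unimodular-L⁻¹ {y} {b} {x} {a} det =
  ℕP.+-cancelˡ-≡ (x ℕ.* y) _ _ (trans (sym (expandˡ x a y)) (trans det (expandʳ y b x)))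
  where
  expandˡ : ∀ x a y → (x ℕ.+ a) ℕ.* y ≡ x ℕ.* y ℕ.+ a ℕ.* y
  expandˡ = ℕ-Solver.solve-∀
  expandʳ : ∀ y b x → suc ((y ℕ.+ b) ℕ.* x) ≡ x ℕ.* y ℕ.+ suc (b ℕ.* x)
  expandʳ = ℕ-Solver.solve-∀

WordWithColumns : ℕ → ℕ → ℕ → ℕ → Set
WordWithColumns y b x a = ∃[ w ] run w (1 , 0) ≡ (y , b) × run w (0 , 1) ≡ (x , a)

prepend-R : ∀ {y b x a} → WordWithColumns y b x a → WordWithColumns (b ℕ.+ y) b (a ℕ.+ x) a
prepend-R {y} {b} {x} {a} (w , col₁ , col₂) =
  R ∷ w , trans (cong (act R) col₁) (cong (_, b) (ℕP.+-comm y b)) ,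
          trans (cong (act R) col₂) (cong (_, a) (ℕP.+-comm x a))

prepend-L : ∀ {y b x a} → WordWithColumns y b x a → WordWithColumns y (y ℕ.+ b) x (x ℕ.+ a)
prepend-L (w , col₁ , col₂) = L ∷ w , cong (act L) col₁ , cong (act L) col₂

-- by induction on y + b + x + a, which drops by b + a or by y + x when a letter is peeled off
word-with-columns : ∀ {y b x a} → a ℕ.* y ≡ suc (b ℕ.* x) → WordWithColumns y b x a
word-with-columns {y} {b} {x} {a} = bounded (suc (y ℕ.+ b ℕ.+ x ℕ.+ a)) ℕP.≤-refl
  where
  shrink : ∀ {m k n} → 0 ℕ.< k → m ℕ.+ k ℕ.< suc n → m ℕ.< n
  shrink {m} k>0 lt = ℕP.<-≤-trans (ℕP.m<m+n m k>0) (ℕP.≤-pred lt)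
  sizeᴿ : ∀ y b x a → b ℕ.+ y ℕ.+ b ℕ.+ (a ℕ.+ x) ℕ.+ a ≡ y ℕ.+ b ℕ.+ x ℕ.+ a ℕ.+ (b ℕ.+ a)
  sizeᴿ = ℕ-Solver.solve-∀
  sizeᴸ : ∀ y b x a → y ℕ.+ (y ℕ.+ b) ℕ.+ x ℕ.+ (x ℕ.+ a) ≡ y ℕ.+ b ℕ.+ x ℕ.+ a ℕ.+ (y ℕ.+ x)
  sizeᴸ = ℕ-Solver.solve-∀
  bounded : ∀ n {y b x a} → y ℕ.+ b ℕ.+ x ℕ.+ a ℕ.< n → a ℕ.* y ≡ suc (b ℕ.* x) → WordWithColumns y b x a
  bounded (suc n) {y} {b} {x} {a} size< det with unimodular-cases {y} {b} {x} {a} det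
  ... | inj₁ (refl , refl) =
    [] , cong (_, 0) (sym (ℕP.m*n≡1⇒n≡1 a y det)) , cong (0 ,_) (sym (ℕP.m*n≡1⇒m≡1 a y det))
  ... | inj₂ (inj₁ (b≤y , a≤x)) with ℕP.m≤n⇒∃[o]m+o≡n b≤y | ℕP.m≤n⇒∃[o]m+o≡n a≤x
  ...   | y′ , refl | x′ , refl =
    prepend-R (bounded n (shrink b+a>0 (subst (ℕ._< suc n) (sizeᴿ y′ b x′ a) size<))
                         (unimodular-R⁻¹ {y′} {b} {x′} {a} det))
    where
    b+a>0 : 0 ℕ.< b ℕ.+ a
    b+a>0 = ℕP.<-≤-trans (proj₁ (unimodular-positive a (b ℕ.+ y′) det)) (ℕP.m≤n+m a b)
  bounded (suc n) {y} {b} {x} {a} size< det | inj₂ (inj₂ (y≤b , x≤a))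
    with ℕP.m≤n⇒∃[o]m+o≡n y≤b | ℕP.m≤n⇒∃[o]m+o≡n x≤a
  ...   | b′ , refl | a′ , refl =
    prepend-L (bounded n (shrink y+x>0 (subst (ℕ._< suc n) (sizeᴸ y b′ x a′) size<))
                         (unimodular-L⁻¹ {y} {b′} {x} {a′} det))
    where
    y+x>0 : 0 ℕ.< y ℕ.+ x
    y+x>0 = ℕP.<-≤-trans (proj₂ (unimodular-positive (x ℕ.+ a′) y det)) (ℕP.m≤m+n y x)

qact-R-e₂ : qact R e₂ ≋ 𝟙
qact-R-e₂ = (λ n → ℤP.+-identityˡ (unit n)) , (λ n → refl)

qact-L-e₂ : qact L e₂ ≋ e₂
qact-L-e₂ = (λ n → refl) , (λ n → ℤP.+-identityˡ (unit n))

second-column-cases : ∀ t → (∃[ s ] qrun t e₂ ≋ qfrac s × run t (0 , 1) ≡ frac s)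
                          ⊎ (qrun t e₂ ≋ e₂ × run t (0 , 1) ≡ (0 , 1))
second-column-cases []      = inj₂ (≋-refl , refl)
second-column-cases (x ∷ t) with second-column-cases t
... | inj₁ (s , q≋ , ≡n) = inj₁ (x ∷ s , qact-cong x q≋ , cong (act x) ≡n)
second-column-cases (R ∷ t) | inj₂ (q≋ , ≡n) = inj₁ ([] , ≋-trans (qact-cong R q≋) qact-R-e₂ , cong (act R) ≡n)
second-column-cases (L ∷ t) | inj₂ (q≋ , ≡n) = inj₂ (≋-trans (qact-cong L q≋) qact-L-e₂ , cong (act L) ≡n)

second-column : ∀ t → ∃[ s ] qrun (R ∷ t) e₂ ≋ qfrac s × run (R ∷ t) (0 , 1) ≡ frac s
second-column t with second-column-cases t
... | inj₁ (s , q≋ , ≡n) = R ∷ s , qact-cong R q≋ , cong (act R) ≡n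
... | inj₂ (q≋ , ≡n)     = [] , ≋-trans (qact-cong R q≋) qact-R-e₂ , cong (act R) ≡n

-- Negative continued fractions

qstep : ℕ → Pair → Pair
qstep c (r , s) = qint· c r ⊝ shift (+ c - + 1) s , r

qstep-cong : ∀ c {u v} → u ≋ v → qstep c u ≋ qstep c v
qstep-cong c (p , q) = (λ n → cong₂ _-_ (qint·-cong c p n) (q _)) , p

⟦_⟧ : LPoly × LPoly → Pair
⟦ f , g ⟧ = coeff f , coeff g

⟦stepM⟧ : ∀ c X → ⟦ stepM c X ⟧ ≋ qstep c ⟦ X ⟧
⟦stepM⟧ c (f , g) =
  (λ n → trans (coeff--P (qint c *P f) (qpow (+ c - + 1) *P g) n)
               (cong₂ _-_ (coeff-qint*P c f n) (coeff-qpow*P (+ c - + 1) g n))) ,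
  (λ n → refl)

⟦1P,0P⟧ : ⟦ (1P , 0P) ⟧ ≋ e₁
⟦1P,0P⟧ = one , nought
  where
  one : coeff 1P ≗ unit
  one (+ zero) = refl
  one +[1+ _ ] = refl
  one -[1+ _ ] = refl
  nought : coeff 0P ≗ 0ᶜ
  nought (+ zero) = refl
  nought +[1+ _ ] = refl
  nought -[1+ _ ] = refl

⟦foldr-stepM⟧ : ∀ cs → ⟦ List.foldr stepM (1P , 0P) cs ⟧ ≋ List.foldr qstep e₁ cs
⟦foldr-stepM⟧ []       = ⟦1P,0P⟧
⟦foldr-stepM⟧ (c ∷ cs) = ≋-trans (⟦stepM⟧ c (List.foldr stepM (1P , 0P) cs)) (qstep-cong c (⟦foldr-stepM⟧ cs))

qstep-suc : ∀ k Y → qstep (suc k) Y ≋ qrun (replicate k R) (qstep 1 Y)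
qstep-suc zero    Y       = ≋-refl
qstep-suc (suc k) (r , s) = ≋-trans unfold (qact-cong R (qstep-suc k (r , s)))
  where
  index : ∀ n k → n - (+ 1 + (+ 1 + k) - + 1) ≡ n - + 1 - (+ 1 + k - + 1)
  index = solve-∀
  regroup : ∀ a b c → a + b - c ≡ b - c + a
  regroup = solve-∀
  unfold : qstep (suc (suc k)) (r , s) ≋ qact R (qstep (suc k) (r , s))
  unfold = (λ n → trans (cong (_-_ (r n + qint· (suc k) r (n - + 1))) (cong s (index n (+ k))))
                        (regroup (r n) (qint· (suc k) r (n - + 1)) _)) ,
           (λ n → refl)

qstep-1-R : ∀ X → qstep 1 (qact R X) ≋ qact L X
qstep-1-R (r , s) =
  (λ n → trans (cong (_-_ (r (n - + 1) + s n + + 0)) (cong s (index n))) (cancel (r (n - + 1)) (s n))) ,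
  (λ n → refl)
  where
  index : ∀ n → n - (+ 1 - + 1) ≡ n
  index = solve-∀
  cancel : ∀ a b → a + b + + 0 - b ≡ a
  cancel = solve-∀

qfrac-R^k : ∀ k → qfrac (replicate k R) ≋ (qint· (suc k) unit , unit)
qfrac-R^k zero    = (λ n → sym (ℤP.+-identityʳ (unit n))) , (λ n → refl)
qfrac-R^k (suc k) = ≋-trans (qact-cong R (qfrac-R^k k)) ((λ n → ℤP.+-comm _ (unit n)) , (λ n → refl))

run-R^k : ∀ k n d → run (replicate k R) (n , d) ≡ (n ℕ.+ k ℕ.* d , d)
run-R^k zero    n d = cong (_, d) (sym (ℕP.+-identityʳ n))
run-R^k (suc k) n d = trans (cong (act R) (run-R^k k n d)) (cong (_, d) (regroup n k d))
  where
  regroup : ∀ n k d → n ℕ.+ k ℕ.* d ℕ.+ d ≡ n ℕ.+ suc k ℕ.* d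
  regroup = ℕ-Solver.solve-∀

negCF-step : ∀ f n₀ d₀ k e → n₀ ℕ.+ d₀ ≡ suc (suc e) → 0 ℕ.< d₀ →
             negCF (suc f) (n₀ ℕ.+ suc k ℕ.* (n₀ ℕ.+ d₀)) (n₀ ℕ.+ d₀) ≡ suc (suc k) ∷ negCF f (n₀ ℕ.+ d₀) d₀
negCF-step f n₀ d₀ k e D≡ d₀>0 =
  subst (λ D → negCF (suc f) (n₀ ℕ.+ suc k ℕ.* D) D ≡ suc (suc k) ∷ negCF f D d₀) (sym D≡) computed
  where
  D = suc (suc e)
  n₀<D : n₀ ℕ.< D
  n₀<D = subst (n₀ ℕ.<_) D≡ (ℕP.m<m+n n₀ d₀>0)
  quotient : (n₀ ℕ.+ suc k ℕ.* D) ℕD./ D ≡ suc k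
  quotient = trans (ℕD.+-distrib-/-∣ʳ n₀ (divides (suc k) refl))
                   (cong₂ ℕ._+_ (ℕD.m<n⇒m/n≡0 n₀<D) (ℕD.m*n/n≡m (suc k) D))
  expand : ∀ n₀ d₀ k → suc (suc k) ℕ.* (n₀ ℕ.+ d₀) ≡ n₀ ℕ.+ suc k ℕ.* (n₀ ℕ.+ d₀) ℕ.+ d₀
  expand = ℕ-Solver.solve-∀
  remainder : suc (suc k) ℕ.* D ℕ.∸ (n₀ ℕ.+ suc k ℕ.* D) ≡ d₀
  remainder = begin
    suc (suc k) ℕ.* D ℕ.∸ (n₀ ℕ.+ suc k ℕ.* D)
      ≡⟨ cong (λ D → suc (suc k) ℕ.* D ℕ.∸ (n₀ ℕ.+ suc k ℕ.* D)) D≡ ⟨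
    suc (suc k) ℕ.* (n₀ ℕ.+ d₀) ℕ.∸ (n₀ ℕ.+ suc k ℕ.* (n₀ ℕ.+ d₀))
      ≡⟨ cong (ℕ._∸ (n₀ ℕ.+ suc k ℕ.* (n₀ ℕ.+ d₀))) (expand n₀ d₀ k) ⟩
    n₀ ℕ.+ suc k ℕ.* (n₀ ℕ.+ d₀) ℕ.+ d₀ ℕ.∸ (n₀ ℕ.+ suc k ℕ.* (n₀ ℕ.+ d₀))
      ≡⟨ ℕP.m+n∸m≡n (n₀ ℕ.+ suc k ℕ.* (n₀ ℕ.+ d₀)) d₀ ⟩
    d₀ ∎
    where open ≡-Reasoning
  computed : negCF (suc f) (n₀ ℕ.+ suc k ℕ.* D) D ≡ suc (suc k) ∷ negCF f D d₀
  computed = cong₂ (λ c r → c ∷ negCF f D r) (cong suc quotient)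
                   (trans (cong (λ c → c ℕ.* D ℕ.∸ (n₀ ℕ.+ suc k ℕ.* D)) (cong suc quotient)) remainder)

data RPrefix : Word → Set where
  R^k   : ∀ k → RPrefix (replicate k R)
  R^k-L : ∀ k u → RPrefix (replicate k R ++ L ∷ u)

rPrefix : ∀ w → RPrefix w
rPrefix []      = R^k 0
rPrefix (L ∷ u) = R^k-L 0 u
rPrefix (R ∷ w) with rPrefix w
... | R^k k     = R^k (suc k)
... | R^k-L k u = R^k-L (suc k) u

frac-R^k-L : ∀ k u → let (n₀ , d₀) = frac u in frac (replicate k R ++ L ∷ u) ≡ (n₀ ℕ.+ k ℕ.* (n₀ ℕ.+ d₀) , n₀ ℕ.+ d₀)
frac-R^k-L k u = trans (run-++ (replicate k R) (L ∷ u) (1 , 1)) (run-R^k k _ _)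

negCF-R^k : ∀ f k → 1 ℕ.≤ f → List.foldr qstep e₁ (negCF f (suc k) 1) ≋ qfrac (replicate k R)
negCF-R^k (suc f) k _ = ≋-trans ((λ n → ℤP.+-identityʳ _) , (λ n → refl)) (≋-sym (qfrac-R^k k))

negCF-R^k-L : ∀ f k u → let (n₀ , d₀) = frac u in
  List.foldr qstep e₁ (negCF f (n₀ ℕ.+ d₀) d₀) ≋ qfrac (R ∷ u) →
  List.foldr qstep e₁ (negCF (suc f) (n₀ ℕ.+ suc k ℕ.* (n₀ ℕ.+ d₀)) (n₀ ℕ.+ d₀))
    ≋ qfrac (replicate (suc k) R ++ L ∷ u)
negCF-R^k-L f k u ih = begin
  List.foldr qstep e₁ (negCF (suc f) (n₀ ℕ.+ suc k ℕ.* (n₀ ℕ.+ d₀)) (n₀ ℕ.+ d₀))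
    ≡⟨ cong (List.foldr qstep e₁) (negCF-step f n₀ d₀ k _ (sum-of-positives n₀>0 d₀>0) d₀>0) ⟩
  qstep (suc (suc k)) (List.foldr qstep e₁ (negCF f (n₀ ℕ.+ d₀) d₀))
    ≈⟨ qstep-cong (suc (suc k)) ih ⟩
  qstep (suc (suc k)) (qact R (qfrac u))
    ≈⟨ qstep-suc (suc k) (qact R (qfrac u)) ⟩
  qrun (replicate (suc k) R) (qstep 1 (qact R (qfrac u)))
    ≈⟨ qrun-cong (replicate (suc k) R) (qstep-1-R (qfrac u)) ⟩
  qrun (replicate (suc k) R) (qfrac (L ∷ u))
    ≡⟨ qrun-++ (replicate (suc k) R) (L ∷ u) 𝟙 ⟨
  qfrac (replicate (suc k) R ++ L ∷ u) ∎
  where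
  open ≋-Reasoning
  n₀ = proj₁ (frac u)
  d₀ = proj₂ (frac u)
  n₀>0 = proj₁ (frac-positive u)
  d₀>0 = proj₂ (frac-positive u)
  sum-of-positives : ∀ {a b} → 0 ℕ.< a → 0 ℕ.< b → a ℕ.+ b ≡ suc (suc (ℕ.pred a ℕ.+ ℕ.pred b))
  sum-of-positives {suc a} {suc b} _ _ = cong suc (ℕP.+-suc a b)

negCF-word : ∀ f w {n d} → frac w ≡ (n , d) → d ℕ.< n → d ℕ.≤ f → List.foldr qstep e₁ (negCF f n d) ≋ qfrac w
negCF-word f w = go f w (rPrefix w)
  where
  Goal : ℕ → Word → ℕ → ℕ → Set
  Goal f w n d = List.foldr qstep e₁ (negCF f n d) ≋ qfrac w
  go : ∀ f w → RPrefix w → ∀ {n d} → frac w ≡ (n , d) → d ℕ.< n → d ℕ.≤ f → Goal f w n d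
  go f _ (R^k k) eq d<n d≤f =
    subst₂ (Goal f (replicate k R)) (cong proj₁ eq′) (cong proj₂ eq′)
           (negCF-R^k f k (subst (ℕ._≤ f) (sym (cong proj₂ eq′)) d≤f))
    where
    eq′ : (suc k , 1) ≡ _
    eq′ = trans (cong (_, 1) (cong suc (sym (ℕP.*-identityʳ k)))) (trans (sym (run-R^k k 1 1)) eq)
  go f _ (R^k-L zero u) eq d<n _ =
    ⊥-elim (ℕP.≤⇒≯ (subst₂ ℕ._≤_ (cong proj₁ eq) (cong proj₂ eq) (ℕP.m≤m+n (proj₁ (frac u)) _)) d<n)
  go zero _ (R^k-L (suc k) u) eq d<n d≤0 =
    ⊥-elim (ℕP.≤⇒≯ d≤0 (subst (0 ℕ.<_) (cong proj₂ eq′) (ℕP.<-≤-trans (proj₁ (frac-positive u)) (ℕP.m≤m+n _ _))))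
    where eq′ = trans (sym (frac-R^k-L (suc k) u)) eq
  go (suc f) _ (R^k-L (suc k) u) eq d<n d≤f =
    subst₂ (Goal (suc f) (replicate (suc k) R ++ L ∷ u)) (cong proj₁ eq′) (cong proj₂ eq′) (negCF-R^k-L f k u ih)
    where
    eq′ = trans (sym (frac-R^k-L (suc k) u)) eq
    d₀<d : proj₂ (frac u) ℕ.< proj₁ (frac u) ℕ.+ proj₂ (frac u)
    d₀<d = ℕP.m<n+m _ (proj₁ (frac-positive u))
    d₀≤f : proj₂ (frac u) ℕ.≤ f
    d₀≤f = ℕP.≤-pred (ℕP.≤-trans d₀<d (subst (ℕ._≤ suc f) (sym (cong proj₂ eq′)) d≤f))
    ih = go f (R ∷ u) (rPrefix (R ∷ u)) refl d₀<d d₀≤f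

-- From rationals to words

RSfuel-above-1 : ∀ f p → 1ℚ ℚ.< p → RSfuel f p ≡ RS>1 p
RSfuel-above-1 f p 1<p with 1ℚ ℚP.<? p
... | yes _  = refl
... | no 1≮p = ⊥-elim (1≮p 1<p)

RSfuel-not-above-1 : ∀ f p → ¬ 1ℚ ℚ.< p → let (r , s) = RSfuel f (p ℚ.+ 1ℚ) in
                     RSfuel (suc f) p ≡ (qpow -[1+ 0 ] *P (r -P s) , s)
RSfuel-not-above-1 f p 1≮p with 1ℚ ℚP.<? p
... | yes 1<p = ⊥-elim (1≮p 1<p)
... | no _    = refl

qdown : Pair → Pair
qdown (r , s) = shift -[1+ 0 ] (r ⊝ s) , s

qdown-cong : ∀ {u v} → u ≋ v → qdown u ≋ qdown v
qdown-cong (p , q) = (λ n → cong₂ _-_ (p _) (q _)) , q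

⟦qdown⟧ : ∀ X → ⟦ (qpow -[1+ 0 ] *P (proj₁ X -P proj₂ X) , proj₂ X) ⟧ ≋ qdown ⟦ X ⟧
⟦qdown⟧ (f , g) = (λ n → trans (coeff-qpow*P -[1+ 0 ] (f -P g) n) (coeff--P f g (n - -[1+ 0 ]))) , (λ n → refl)

qdown-R : ∀ X → qdown (qact R X) ≋ X
qdown-R (r , s) = (λ n → trans (cong (λ m → r m + s (n + + 1) - s (n + + 1)) (back n)) (cancel _ _)) , (λ n → refl)
  where
  back : ∀ n → n - -[1+ 0 ] - + 1 ≡ n
  back = solve-∀
  cancel : ∀ a b → a + b - b ≡ a
  cancel = solve-∀

coprime-+ʳ : ∀ {n d} → Coprime n d → Coprime (n ℕ.+ d) d
coprime-+ʳ {n} {d} c = subst (λ m → Coprime m d) (ℕP.+-comm d n) (Coprimality.coprime-+ c)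

module _ {n d-1 : ℕ} .(c : Coprime n (suc d-1)) where

  1<⇒den<num : 1ℚ ℚ.< mkℚ (+ n) d-1 c → suc d-1 ℕ.< n
  1<⇒den<num 1<p =
    ℤP.drop‿+<+ (subst₂ ℤ._<_ (ℤP.*-identityˡ (+ suc d-1)) (ℤP.*-identityʳ (+ n)) (ℚP.drop-*<* 1<p))

  <1⇒num<den : mkℚ (+ n) d-1 c ℚ.< 1ℚ → n ℕ.< suc d-1
  <1⇒num<den p<1 =
    ℤP.drop‿+<+ (subst₂ ℤ._<_ (ℤP.*-identityʳ (+ n)) (ℤP.*-identityˡ (+ suc d-1)) (ℚP.drop-*<* p<1))

  den<num⇒1< : suc d-1 ℕ.< n → 1ℚ ℚ.< mkℚ (+ n) d-1 c
  den<num⇒1< lt =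
    ℚ.*<* (subst₂ ℤ._<_ (sym (ℤP.*-identityˡ (+ suc d-1))) (sym (ℤP.*-identityʳ (+ n))) (ℤ.+<+ lt))

  mkℚ-+1 : mkℚ (+ n) d-1 c ℚ.+ 1ℚ ≡ mkℚ (+ (n ℕ.+ suc d-1)) d-1 (coprime-+ʳ c)
  mkℚ-+1 = trans (ℚP./-cong (numerator (+ n) (+ suc d-1)) (ℕP.*-identityʳ (suc d-1))) (ℚP.normalize-coprime _)
    where
    numerator : ∀ a b → a * + 1 + + 1 * b ≡ a + b
    numerator = solve-∀

RS>1-word : ∀ n d-1 .(c : Coprime n (suc d-1)) w → frac w ≡ (n , suc d-1) → 1ℚ ℚ.< mkℚ (+ n) d-1 c →
            ∀ f → ⟦ RSfuel f (mkℚ (+ n) d-1 c) ⟧ ≋ qfrac w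
RS>1-word n d-1 c w eq 1<p f = begin
  ⟦ RSfuel f (mkℚ (+ n) d-1 c) ⟧
    ≡⟨ cong ⟦_⟧ (RSfuel-above-1 f _ 1<p) ⟩
  ⟦ List.foldr stepM (1P , 0P) (negCF (suc d-1) n (suc d-1)) ⟧
    ≈⟨ ⟦foldr-stepM⟧ (negCF (suc d-1) n (suc d-1)) ⟩
  List.foldr qstep e₁ (negCF (suc d-1) n (suc d-1))
    ≈⟨ negCF-word (suc d-1) w eq (1<⇒den<num c 1<p) ℕP.≤-refl ⟩
  qfrac w ∎
  where open ≋-Reasoning

RS-word : ∀ n d-1 .(c : Coprime n (suc d-1)) w → frac w ≡ (n , suc d-1) → ⟦ RS (mkℚ (+ n) d-1 c) ⟧ ≋ qfrac w
RS-word n d-1 c w eq = by-cases (1ℚ ℚP.<? p)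
  where
  p = mkℚ (+ n) d-1 c
  X = RSfuel (suc n) (p ℚ.+ 1ℚ)
  n>0 : 0 ℕ.< n
  n>0 = subst (0 ℕ.<_) (cong proj₁ eq) (proj₁ (frac-positive w))
  X-word : ⟦ X ⟧ ≋ qfrac (R ∷ w)
  X-word = ≋-trans (≡⇒≋ (cong (λ q → ⟦ RSfuel (suc n) q ⟧) (mkℚ-+1 c)))
                   (RS>1-word (n ℕ.+ suc d-1) d-1 (coprime-+ʳ c) (R ∷ w) (cong (act R) eq)
                              (den<num⇒1< (coprime-+ʳ c) (ℕP.m<n+m (suc d-1) n>0)) (suc n))
  by-cases : Dec (1ℚ ℚ.< p) → ⟦ RS p ⟧ ≋ qfrac w
  by-cases (yes 1<p) = RS>1-word n d-1 c w eq 1<p _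
  by-cases (no 1≮p) = begin
    ⟦ RS p ⟧
      ≡⟨ cong ⟦_⟧ (trans (cong (λ f → RSfuel f p) (ℕP.+-comm n 2)) (RSfuel-not-above-1 (suc n) p 1≮p)) ⟩
    ⟦ (qpow -[1+ 0 ] *P (proj₁ X -P proj₂ X) , proj₂ X) ⟧  ≈⟨ ⟦qdown⟧ X ⟩
    qdown ⟦ X ⟧                                             ≈⟨ qdown-cong X-word ⟩
    qdown (qact R (qfrac w))                                ≈⟨ qdown-R (qfrac w) ⟩
    qfrac w                                                 ∎
    where open ≋-Reasoning

-- The words of α, 1/α, 𝔦(α), 𝔯(α) and 1/γ

RS-frac : ∀ {n} p w → ↥ p ≡ + n → frac w ≡ (n , ↧ₙ p) → ⟦ RS p ⟧ ≋ qfrac w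
RS-frac (mkℚ _ d-1 c) w refl frac≡ = RS-word _ d-1 c w frac≡

RS-/ : ∀ {n} i d-1 w → i ≡ + n → frac w ≡ (n , suc d-1) → ⟦ RS (i ℚ./ suc d-1) ⟧ ≋ qfrac w
RS-/ {n} _ d-1 w refl frac≡ =
  subst (λ p → ⟦ RS p ⟧ ≋ qfrac w) (sym (ℚP.normalize-coprime coprime)) (RS-word n d-1 coprime w frac≡)
  where
  coprime : Coprime n (suc d-1)
  coprime = subst₂ Coprime (cong proj₁ frac≡) (cong proj₂ frac≡) (frac-coprime w)

-- c x = a z − 1 and c y = 1 + b z, which force x ≥ 0 and y > 0
parent-scaled-numerators : ∀ {α β γ} → FareyParent α β γ →
  (↧ α * ↥ β ≡ ↧ β * ↥ α - + 1) × (↧ α * ↥ γ ≡ + 1 + ↧ γ * ↥ α)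
parent-scaled-numerators {α} {β} {γ} fp =
  trans (cong (_* ↥ β) (cong +_ den≡)) (trans (scaledˣ (↧ β) (↧ γ) (↥ β) (↥ γ))
        (cong₂ (λ Z det → ↧ β * Z - det) (sym num≡) neighbors)) ,
  trans (cong (_* ↥ γ) (cong +_ den≡)) (trans (scaledʸ (↧ β) (↧ γ) (↥ β) (↥ γ))
        (cong₂ (λ det Z → det + ↧ γ * Z) neighbors (sym num≡)))
  where
  open FareyParent fp
  scaledˣ : ∀ A B X Y → (A + B) * X ≡ A * (X + Y) - (A * Y - B * X)
  scaledˣ = solve-∀
  scaledʸ : ∀ A B X Y → (A + B) * Y ≡ (A * Y - B * X) + B * (X + Y)
  scaledʸ = solve-∀

determinant-ℕ : ∀ {y b x a} → + a * + y - + b * + x ≡ + 1 → a ℕ.* y ≡ suc (b ℕ.* x)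
determinant-ℕ {y} {b} {x} {a} det = ℤP.+-injective (begin
  + (a ℕ.* y)              ≡⟨ ℤP.pos-* a y ⟩
  + a * + y                ≡⟨ split (+ a * + y) (+ b * + x) ⟩
  + a * + y - + b * + x + + b * + x ≡⟨ cong (_+ + b * + x) det ⟩
  + 1 + + b * + x          ≡⟨ cong (_+_ (+ 1)) (ℤP.pos-* b x) ⟨
  + suc (b ℕ.* x)          ∎)
  where
  open ≡-Reasoning
  split : ∀ p q → p ≡ p - q + q
  split = solve-∀

parent-word : ∀ {y b x a} → a ℕ.* y ≡ suc (b ℕ.* x) → y ℕ.+ x ℕ.< b ℕ.+ a →
              ∃[ u ] run (L ∷ u) (1 , 0) ≡ (y , b) × run (L ∷ u) (0 , 1) ≡ (x , a)
parent-word {y} {b} {x} {a} det y+x<b+a with word-with-columns {y} {b} {x} {a} det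
... | []    , refl , refl = ⊥-elim (ℕP.<-irrefl refl y+x<b+a)
... | R ∷ w , col₁ , col₂ = ⊥-elim (ℕP.≤⇒≯ (ℕP.+-mono-≤ (dominated col₁) (dominated col₂)) y+x<b+a)
  where
  dominated : ∀ {v n d} → act R v ≡ (n , d) → d ℕ.≤ n
  dominated refl = ℕP.m≤n+m _ _
... | L ∷ u , col₁ , col₂ = u , col₁ , col₂

module ParentWord {y b x a z c : ℕ} (u : Word)
  (col₁ : run (L ∷ u) (1 , 0) ≡ (y , b)) (col₂ : run (L ∷ u) (0 , 1) ≡ (x , a))
  (y+x≡z : y ℕ.+ x ≡ z) (b+a≡c : b ℕ.+ a ≡ c) where

  frac-L∷u : frac (L ∷ u) ≡ (z , c)
  frac-L∷u = trans (frac-columns (L ∷ u)) (trans (cong₂ _+²_ col₁ col₂) (cong₂ _,_ y+x≡z b+a≡c))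

  frac-flip : frac (flipWord (L ∷ u)) ≡ (c , z)
  frac-flip = trans (run-flipWord (L ∷ u) (1 , 1)) (cong swap frac-L∷u)

  𝔦-numerator : + c - + z ≡ + proj₂ (frac u)
  𝔦-numerator = trans (cong₂ (λ c z → + c - + z) (cong proj₂ (sym frac-L∷u)) (cong proj₁ (sym frac-L∷u)))
                      (cancel (+ proj₁ (frac u)) (+ proj₂ (frac u)))
    where
    cancel : ∀ n d → n + d - n ≡ d
    cancel = solve-∀

  frac-L∷flip : frac (L ∷ flipWord u) ≡ (proj₂ (frac u) , c)
  frac-L∷flip = trans (cong (act L) (run-flipWord u (1 , 1)))
                      (cong (proj₂ (frac u) ,_) (trans (ℕP.+-comm (proj₂ (frac u)) _) (cong proj₂ frac-L∷u)))

  frac-L∷reverse : frac (L ∷ reverse u) ≡ (a , c)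
  frac-L∷reverse = trans (cong (act L) frac-reverse) (cong (a ,_) (trans (ℕP.+-comm a b) b+a≡c))
    where
    frac-reverse : frac (reverse u) ≡ (a , b)
    frac-reverse = trans (frac-columns (reverse u))
                         (trans (cong₂ _+²_ (proj₁ (run-reverse u)) (proj₂ (run-reverse u)))
                                (cong₂ _,_ (trans (ℕP.+-comm (proj₂ (run u (0 , 1))) _) (cong proj₂ col₂))
                                           (trans (ℕP.+-comm (proj₂ (run u (1 , 0))) _) (cong proj₂ col₁))))

  run-R∷flip : run (R ∷ flipWord u) (0 , 1) ≡ (b , y)
  run-R∷flip = trans (run-flipWord (L ∷ u) (1 , 0)) (cong swap col₁)

record FareyWords (α β γ : ℚ) : Set where
  field
    u s      : Word
    α-word   : ⟦ RS α ⟧ ≋ qfrac (L ∷ u)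
    α⁻¹-word : ⟦ RS (inv α) ⟧ ≋ qfrac (flipWord (L ∷ u))
    𝔦-word   : ⟦ RS (𝔦 α) ⟧ ≋ qfrac (L ∷ flipWord u)
    𝔯-word   : ⟦ RS (𝔯 α β) ⟧ ≋ qfrac (L ∷ reverse u)
    γ⁻¹-word : ⟦ RS (inv γ) ⟧ ≋ qfrac s
    s-column : qrun (flipWord (L ∷ u)) e₂ ≋ qfrac s

private
  negative≢ : ∀ {c k m} → +[1+ c ] * -[1+ k ] ≢ + m
  negative≢ ()

  zero≢suc : ∀ {m} → + 0 ≢ +[1+ m ]
  zero≢suc ()

farey-words : ∀ α β γ → 0ℚ ℚ.< α → α ℚ.< 1ℚ → FareyParent α β γ → FareyWords α β γ
farey-words (mkℚ (+ zero) _ _) _ _ (ℚ.*<* 0<0) _ _ = ⊥-elim (ℤP.<-irrefl refl 0<0)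
farey-words (mkℚ -[1+ _ ] _ _) _ _ (ℚ.*<* ()) _ _
farey-words (mkℚ +[1+ _ ] c-1 _) (mkℚ -[1+ k ] _ _) _ _ _ fp =
  ⊥-elim (negative≢ {c-1} {k} (proj₁ (parent-scaled-numerators fp)))
farey-words (mkℚ +[1+ _ ] c-1 _) (mkℚ (+ _) _ _) (mkℚ (+ zero) _ _) _ _ fp =
  ⊥-elim (zero≢suc (trans (sym (ℤP.*-zeroʳ +[1+ c-1 ])) (proj₂ (parent-scaled-numerators fp))))
farey-words (mkℚ +[1+ _ ] c-1 _) (mkℚ (+ _) _ _) (mkℚ -[1+ k ] _ _) _ _ fp =
  ⊥-elim (negative≢ {c-1} {k} (proj₂ (parent-scaled-numerators fp)))
farey-words α@(mkℚ +[1+ z′ ] c-1 _) (mkℚ (+ x) a-1 _) γ@(mkℚ +[1+ y′ ] b-1 _) _ α<1 fp = record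
  { u = u ; s = proj₁ second
  ; α-word   = RS-frac α (L ∷ u) refl frac-L∷u
  ; α⁻¹-word = RS-frac (inv α) (flipWord (L ∷ u)) refl frac-flip
  ; 𝔦-word   = RS-/ _ c-1 (L ∷ flipWord u) 𝔦-numerator frac-L∷flip
  ; 𝔯-word   = RS-/ _ c-1 (L ∷ reverse u) refl frac-L∷reverse
  ; γ⁻¹-word = RS-frac (inv γ) (proj₁ second) refl (trans (sym (proj₂ (proj₂ second))) run-R∷flip)
  ; s-column = proj₁ (proj₂ second) }
  where
  open FareyParent fp
  y+x≡z : suc y′ ℕ.+ x ≡ suc z′
  y+x≡z = trans (ℕP.+-comm (suc y′) x) (sym (ℤP.+-injective num≡))
  b+a≡c : suc b-1 ℕ.+ suc a-1 ≡ suc c-1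
  b+a≡c = trans (ℕP.+-comm (suc b-1) _) (sym den≡)
  parent = parent-word {suc y′} {suc b-1} {x} {suc a-1} (determinant-ℕ {suc y′} {suc b-1} {x} {suc a-1} neighbors)
                       (subst₂ ℕ._<_ (sym y+x≡z) (sym b+a≡c) (<1⇒num<den {suc z′} {c-1} _ α<1))
  u = proj₁ parent
  open ParentWord u (proj₁ (proj₂ parent)) (proj₂ (proj₂ parent)) y+x≡z b+a≡c
  second = second-column (flipWord u)

module _ {α β γ : ℚ} (F : FareyWords α β γ) where
  open FareyWords F

  private
    D = + suc (length u)

  vee-𝓢 : ∀ n → coeff (vee (𝓢 α)) n ≡ 𝓢ʷ (L ∷ u) (D - n)
  vee-𝓢 n = trans (coeff-vee (𝓢 α) D top≢0 above n) (proj₂ α-word (D - n))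
    where
    top≢0 : coeff (𝓢 α) D ≢ + 0
    top≢0 eq with trans (sym (qfrac-L-top u)) (trans (sym (proj₂ α-word D)) eq)
    ... | ()
    above : ∀ m → D ℤ.< m → coeff (𝓢 α) m ≡ + 0
    above m D<m = trans (proj₂ α-word m) (Degree.s-above (qfrac-degree (L ∷ u)) m D<m)

  𝓢-𝔯≈vee-𝓢 : 𝓢 (𝔯 α β) ≈ vee (𝓢 α)
  𝓢-𝔯≈vee-𝓢 n = trans (proj₂ 𝔯-word n) (trans (𝓢ʷ-L∷reverse u n) (sym (vee-𝓢 n)))

  vee-𝓢≈𝓢-𝔦 : vee (𝓢 α) ≈ 𝓢 (𝔦 α)
  vee-𝓢≈𝓢-𝔦 n = trans (vee-𝓢 n) (trans (sym (𝓢ʷ-L∷flip u n)) (sym (proj₂ 𝔦-word n)))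

  -- qact L and qact R produce the same polynomial q r + s, in different slots
  𝓢-𝔦≈𝓡-inv : 𝓢 (𝔦 α) ≈ 𝓡 (inv α)
  𝓢-𝔦≈𝓡-inv n = trans (proj₂ 𝔦-word n) (sym (proj₁ α⁻¹-word n))

  𝓡-𝔦≈𝓡-inv-𝓢-inv : 𝓡 (𝔦 α) ≈ 𝓡 (inv α) -P 𝓢 (inv α)
  𝓡-𝔦≈𝓡-inv-𝓢-inv n =
    trans (proj₁ 𝔦-word n) (trans (𝓡ʷ-L (flipWord u) n)
    (sym (trans (coeff--P (𝓡 (inv α)) (𝓢 (inv α)) n) (cong₂ _-_ (proj₁ α⁻¹-word n) (proj₂ α⁻¹-word n)))))

  𝓡-𝔯≈𝓡-inv-𝓡-invγ : 𝓡 (𝔯 α β) ≈ 𝓡 (inv α) -P 𝓡 (inv γ)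
  𝓡-𝔯≈𝓡-inv-𝓡-invγ n =
    trans (proj₁ 𝔯-word n) (trans (𝓡ʷ-L∷reverse u n)
    (sym (trans (coeff--P (𝓡 (inv α)) (𝓡 (inv γ)) n)
                (cong₂ _-_ (proj₁ α⁻¹-word n) (trans (proj₁ γ⁻¹-word n) (sym (proj₁ s-column n)))))))

proposition5p3 : (α β γ : ℚ) → 0ℚ < α → α < 1ℚ → FareyParent α β γ →
    (𝓢 (𝔯 α β) ≈ vee (𝓢 α)) × (vee (𝓢 α) ≈ 𝓢 (𝔦 α)) × (𝓢 (𝔦 α) ≈ 𝓡 (inv α))
    × (𝓡 (𝔦 α) ≈ 𝓡 (inv α) -P 𝓢 (inv α))
    × (𝓡 (𝔯 α β) ≈ 𝓡 (inv α) -P 𝓡 (inv γ))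
proposition5p3 α β γ 0<α α<1 parent =
  𝓢-𝔯≈vee-𝓢 F , vee-𝓢≈𝓢-𝔦 F , 𝓢-𝔦≈𝓡-inv F , 𝓡-𝔦≈𝓡-inv-𝓢-inv F , 𝓡-𝔯≈𝓡-inv-𝓡-invγ F
  where F = farey-words α β γ 0<α α<1 parent
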